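{- Let $a_{n,0}$ denote the number of matchings of size $n$ with no occurrence of the endhered pattern $21$. For all $n\ge 0$, $$a_{n+1,0}=\sum_{k=0}^{n}(-1)^{n-k}\binom{n}{k}(2k+1)!!,$$ where $(2k+1)!!=(2k+1)(2k-1)\cdots 3\cdot 1$.
   Context: A (perfect) matching of size $n$ is a partition of $\{1,\dots,2n\}$ into $n$ two-element sets called arcs. An occurrence of the endhered pattern $21$ in a matching $\mu$ of size $n$ is a pair of integers $(i,j)$ with $i\ge0$, $i+2\le j$, $j+2\le 2n$, such that $\{i+1,j+2\}$ and $\{i+2,j+1\}$ are both arcs of $\mu$. -}

module Defs where

open import Data.Bool using (Bool; true; false; not; _∧_; T)
open import Data.Nat as ℕ using (ℕ; zero; suc; _+_; _*_; _∸_)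
open import Data.Nat.Combinatorics using (_C_)
open import Data.Fin using (Fin; toℕ)
open import Data.Fin.Properties using () renaming (_≟_ to _≟ᶠ_)
open import Data.Vec using (Vec; lookup)
open import Data.List using (List; upTo; map; foldr; allFin)
open import Data.Bool.ListAction using (all; any)
open import Data.Product using (Σ)
open import Data.Integer as ℤ using (ℤ; +_; -_)
open import Relation.Nullary.Decidable using (⌊_⌋)

-- Points of {1,…,2n} are represented 0-indexed as Fin (2 * n): point p ↦ p - 1.
-- A (perfect) matching of size n is encoded by its fixed-point-free involution
-- μ : Fin (2n) → Fin (2n), stored as a vector; {a,b} is an arc iff μ a = b.
isMatching : {m : ℕ} → Vec (Fin m) m → Bool
isMatching {m} v =
  all (λ x → not ⌊ lookup v x ≟ᶠ x ⌋ ∧ ⌊ lookup v (lookup v x) ≟ᶠ x ⌋) (allFin m)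

isArc : {m : ℕ} → Vec (Fin m) m → ℕ → ℕ → Bool
isArc {m} v a b =
  any (λ x → ⌊ toℕ x ℕ.≟ a ⌋ ∧ ⌊ toℕ (lookup v x) ℕ.≟ b ⌋) (allFin m)

-- occurs21 n v i j : (i , j) is an occurrence of the endhered pattern 21, i.e.
-- i + 2 ≤ j, j + 2 ≤ 2n, and {i+1, j+2}, {i+2, j+1} (1-indexed) are arcs;
-- 0-indexed these are the arcs {i, j+1} and {i+1, j}.
occurs21 : (n : ℕ) → Vec (Fin (2 * n)) (2 * n) → ℕ → ℕ → Bool
occurs21 n v i j =
  ⌊ i + 2 ℕ.≤? j ⌋ ∧ ⌊ j + 2 ℕ.≤? 2 * n ⌋ ∧ isArc v i (j + 1) ∧ isArc v (i + 1) j

-- Some occurrence exists (all possible i, j are < 2n, so the search is complete).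
has21 : (n : ℕ) → Vec (Fin (2 * n)) (2 * n) → Bool
has21 n v = any (λ i → any (λ j → occurs21 n v i j) (upTo (2 * n))) (upTo (2 * n))

Avoid21 : ℕ → Set
Avoid21 n = Σ (Vec (Fin (2 * n)) (2 * n)) (λ v → T (isMatching v ∧ not (has21 n v)))

oddDoubleFact : ℕ → ℕ
oddDoubleFact zero = 1
oddDoubleFact (suc k) = (2 * suc k + 1) * oddDoubleFact k

rhs : ℕ → ℤ
rhs n = foldr ℤ._+_ (+ 0)
  (map (λ k → ((- (+ 1)) ℤ.^ (n ∸ k)) ℤ.* (+ ((n C k) * oddDoubleFact k))) (upTo (suc n)))

-- Write a matching as a fixed-point-free involution and call the rank of an occurrence (i, j)
-- of 21 the number of arcs opened before i. Let a(N, n) count the matchings of size N without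
-- occurrences of rank ≥ n. Then a_{N,0} = a(N, 0), and a(n + 1, n) = (2n + 1)!! because the
-- openers i and i + 1 of an occurrence leave it rank at most n - 1 in a matching of size n + 1.
-- Nesting a new arc immediately inside the arc of rank n creates an occurrence of rank n and
-- raises the rank of every other occurrence by one; conversely, a matching with no occurrence of
-- rank ≥ n + 1 has at most one of rank n, and its inner arc can be removed. Hence
-- a(N + 1, n + 1) = a(N + 1, n) + a(N, n), so a(r + n + 1, n) is the r-th forward difference of
-- k ↦ (2k + 1)!! at n, whose binomial expansion at n = 0 is the stated alternating sum.

module Submission where

module FiniteDifferences where

  open import Data.Nat as ℕ using (ℕ; zero; suc; _∸_)
  import Data.Nat.Properties as ℕP
  open import Data.Nat.Combinatorics using (_C_; nCk+nC[k+1]≡[n+1]C[k+1]; k>n⇒nCk≡0)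
  open import Data.Fin as Fin using (Fin; toℕ; fromℕ; inject₁)
  open import Data.Fin.Properties using (toℕ-inject₁; toℕ-fromℕ; toℕ≤pred[n])
  open import Data.Integer using (ℤ; +_; -1ℤ; _+_; _-_; _*_; _^_)
  import Data.Integer.Properties as ℤP
  open import Data.Integer.Tactic.RingSolver using (solve-∀)
  open import Algebra.Properties.Semiring.Sum ℤP.+-*-semiring
    using (sum; sum-syntax; sum⁺-syntax; sum-cong-≗; ∑-distrib-+; *-distribˡ-sum; sum-init-last)
  open import Data.List as List using (foldr; applyUpTo)
  open import Function using (_∘_)
  open import Relation.Binary.PropositionalEquality
  open import Defs using (oddDoubleFact; rhs)

  Δ : ℕ → (ℕ → ℤ) → ℕ → ℤ
  Δ zero    x n = x n
  Δ (suc r) x n = Δ r x (suc n) - Δ r x n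

  binomialTerm : ℕ → (ℕ → ℤ) → ℕ → ℤ
  binomialTerm r y k = -1ℤ ^ (r ∸ k) * (+ (r C k) * y k)

  binomialTransform : ℕ → (ℕ → ℤ) → ℤ
  binomialTransform r y = ∑[ k ≤ r ] binomialTerm r y (toℕ k)

  binomialTransform-cong : ∀ r {y z} → (∀ k → y k ≡ z k) → binomialTransform r y ≡ binomialTransform r z
  binomialTransform-cong r y≗z =
    sum-cong-≗ {suc r} (λ k → cong (λ u → -1ℤ ^ (r ∸ toℕ k) * (+ (r C toℕ k) * u)) (y≗z (toℕ k)))

  binomialTransform-suc : ∀ r y →
    binomialTransform (suc r) y ≡ binomialTransform r (y ∘ suc) - binomialTransform r y
  binomialTransform-suc r y = begin
      binomialTransform (suc r) y
    ≡⟨ cong (λ z → Q 0 + z) (trans (sum-cong-≗ {suc r} pascal) (∑-distrib-+ P (Q ∘ suc ∘ toℕ))) ⟩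
      Q 0 + (∑[ k ≤ r ] P k + ∑[ k ≤ r ] Q (suc (toℕ k)))
    ≡⟨ x+[y+z]≡y+[x+z] (Q 0) (sum P) (∑[ k ≤ r ] Q (suc (toℕ k))) ⟩
      ∑[ k ≤ r ] P k + ∑[ k ≤ suc r ] Q (toℕ k)
    ≡⟨ cong (λ z → sum P + z) (trans (sum-init-last {suc r} (Q ∘ toℕ)) last-vanishes) ⟩
      ∑[ k ≤ r ] P k + ∑[ k ≤ r ] Q (toℕ k)
    ≡⟨ cong (λ z → sum P + z) (trans (sum-cong-≗ {suc r} flip-sign)
                                      (sym (*-distribˡ-sum {suc r} -1ℤ (binomialTerm r y ∘ toℕ)))) ⟩
      binomialTransform r (y ∘ suc) + -1ℤ * binomialTransform r y
    ≡⟨ x+-1*y≡x-y (binomialTransform r (y ∘ suc)) (binomialTransform r y) ⟩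
      binomialTransform r (y ∘ suc) - binomialTransform r y ∎
    where
    open ≡-Reasoning
    P : Fin (suc r) → ℤ
    P = binomialTerm r (y ∘ suc) ∘ toℕ
    Q : ℕ → ℤ
    Q k = -1ℤ ^ (suc r ∸ k) * (+ (r C k) * y k)
    x+[y+z]≡y+[x+z] : ∀ x y z → x + (y + z) ≡ y + (x + z)
    x+[y+z]≡y+[x+z] = solve-∀
    x+-1*y≡x-y : ∀ x y → x + -1ℤ * y ≡ x - y
    x+-1*y≡x-y = solve-∀
    pascal : ∀ k → binomialTerm (suc r) y (suc (toℕ k)) ≡ P k + Q (suc (toℕ k))
    pascal k = begin
        s * (+ (suc r C suc (toℕ k)) * z)
      ≡⟨ cong (λ c → s * (+ c * z)) (sym (nCk+nC[k+1]≡[n+1]C[k+1] r (toℕ k))) ⟩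
        s * (+ (r C toℕ k ℕ.+ r C suc (toℕ k)) * z)
      ≡⟨ cong (λ c → s * (c * z)) (ℤP.pos-+ (r C toℕ k) _) ⟩
        s * ((+ (r C toℕ k) + + (r C suc (toℕ k))) * z)
      ≡⟨ distrib s (+ (r C toℕ k)) (+ (r C suc (toℕ k))) z ⟩
        P k + Q (suc (toℕ k)) ∎
      where
      s = -1ℤ ^ (r ∸ toℕ k)
      z = y (suc (toℕ k))
      distrib : ∀ s a b z → s * ((a + b) * z) ≡ s * (a * z) + s * (b * z)
      distrib = solve-∀
    last-vanishes : ∑[ k ≤ r ] Q (toℕ (inject₁ k)) + Q (toℕ (fromℕ (suc r))) ≡ ∑[ k ≤ r ] Q (toℕ k)
    last-vanishes = begin
        ∑[ k ≤ r ] Q (toℕ (inject₁ k)) + Q (toℕ (fromℕ (suc r)))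
      ≡⟨ cong₂ _+_ (sum-cong-≗ {suc r} (cong Q ∘ toℕ-inject₁)) (cong Q (toℕ-fromℕ (suc r))) ⟩
        ∑[ k ≤ r ] Q (toℕ k) + Q (suc r)
      ≡⟨ cong (λ c → ∑[ k ≤ r ] Q (toℕ k) + -1ℤ ^ (r ∸ r) * (+ c * y (suc r)))
              (k>n⇒nCk≡0 (ℕP.n<1+n r)) ⟩
        ∑[ k ≤ r ] Q (toℕ k) + -1ℤ ^ (r ∸ r) * (+ 0 * y (suc r))
      ≡⟨ x+s*[0*z]≡x (∑[ k ≤ r ] Q (toℕ k)) (-1ℤ ^ (r ∸ r)) (y (suc r)) ⟩
        ∑[ k ≤ r ] Q (toℕ k) ∎
      where
      x+s*[0*z]≡x : ∀ x s z → x + s * (+ 0 * z) ≡ x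
      x+s*[0*z]≡x = solve-∀
    flip-sign : ∀ (k : Fin (suc r)) → Q (toℕ k) ≡ -1ℤ * binomialTerm r y (toℕ k)
    flip-sign k = begin
        -1ℤ ^ (suc r ∸ toℕ k) * X
      ≡⟨ cong (λ e → -1ℤ ^ e * X) (ℕP.+-∸-assoc 1 (toℕ≤pred[n] k)) ⟩
        -1ℤ * -1ℤ ^ (r ∸ toℕ k) * X
      ≡⟨ ℤP.*-assoc -1ℤ (-1ℤ ^ (r ∸ toℕ k)) X ⟩
        -1ℤ * (-1ℤ ^ (r ∸ toℕ k) * X) ∎
      where X = + (r C toℕ k) * y (toℕ k)

  Δ-binomial : ∀ r x n → Δ r x n ≡ binomialTransform r (λ k → x (n ℕ.+ k))
  Δ-binomial zero x n = begin
      x n                                      ≡⟨ cong x (ℕP.+-identityʳ n) ⟨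
      x (n ℕ.+ 0)                              ≡⟨ unit (x (n ℕ.+ 0)) ⟩
      binomialTransform 0 (λ k → x (n ℕ.+ k)) ∎
    where
    open ≡-Reasoning
    unit : ∀ a → a ≡ + 1 * (+ 1 * a) + + 0
    unit = solve-∀
  Δ-binomial (suc r) x n = begin
      Δ r x (suc n) - Δ r x n
    ≡⟨ cong₂ _-_ (Δ-binomial r x (suc n)) (Δ-binomial r x n) ⟩
      binomialTransform r (λ k → x (suc n ℕ.+ k)) - binomialTransform r (λ k → x (n ℕ.+ k))
    ≡⟨ cong (_- binomialTransform r (λ k → x (n ℕ.+ k)))
            (binomialTransform-cong r (λ k → cong x (sym (ℕP.+-suc n k)))) ⟩
      binomialTransform r (λ k → x (n ℕ.+ suc k)) - binomialTransform r (λ k → x (n ℕ.+ k))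
    ≡⟨ binomialTransform-suc r (λ k → x (n ℕ.+ k)) ⟨
      binomialTransform (suc r) (λ k → x (n ℕ.+ k)) ∎
    where open ≡-Reasoning

  foldr-map-applyUpTo : ∀ (f : ℕ → ℤ) g n →
    foldr _+_ (+ 0) (List.map f (applyUpTo g n)) ≡ ∑[ k < n ] f (g (toℕ k))
  foldr-map-applyUpTo f g zero    = refl
  foldr-map-applyUpTo f g (suc n) = cong (λ s → f (g 0) + s) (foldr-map-applyUpTo f (g ∘ suc) n)

  rhs≡binomialTransform : ∀ r → rhs r ≡ binomialTransform r (λ k → + oddDoubleFact k)
  rhs≡binomialTransform r = trans (foldr-map-applyUpTo term (λ k → k) (suc r))
    (sum-cong-≗ {suc r} λ k →
      cong (λ c → -1ℤ ^ (r ∸ toℕ k) * c) (ℤP.pos-* (r C toℕ k) (oddDoubleFact (toℕ k))))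
    where
    term : ℕ → ℤ
    term k = -1ℤ ^ (r ∸ k) * + ((r C k) ℕ.* oddDoubleFact k)

open import Data.Nat
open import Data.Nat.Properties
open import Algebra.Properties.CommutativeSemigroup +-commutativeSemigroup using (x∙yz≈y∙xz)
open import Data.Bool using (Bool; true; false; T; not; _∧_)
open import Data.Bool.Properties using (T-∧; T-≡; T-irrelevant)
open import Data.Bool.ListAction using (all; any)
open import Data.Unit using (⊤; tt)
open import Data.Empty using (⊥-elim)
open import Data.Product using (Σ; ∃; ∃₂; _×_; _,_; proj₁; proj₂)
open import Data.Product.Function.NonDependent.Propositional using (_×-↔_)
open import Data.Sum using (_⊎_; inj₁; inj₂)
open import Data.Sum.Properties using (inj₂-injective)
open import Data.Sum.Algebra using (⊎-cong; ⊎-comm; ⊎-assoc)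
open import Data.Fin as Fin using (Fin; toℕ; fromℕ<)
open import Data.Fin.Properties using (toℕ-injective; toℕ<n; toℕ-fromℕ<; *↔×; 1↔⊤; +↔⊎) renaming (_≟_ to _≟ᶠ_)
open import Data.Vec using (Vec; []; _∷_; lookup; tabulate)
open import Data.Vec.Properties using (lookup∘tabulate)
open import Data.List using (upTo; allFin)
import Data.List.Relation.Unary.All.Properties as All
import Data.List.Relation.Unary.Any.Properties as Any
open import Data.Integer as ℤ using (ℤ; +_)
import Data.Integer.Properties as ℤP
open import Data.Integer.Tactic.RingSolver using (solve-∀)
open import Function using (_∘_; _∘′_; case_of_; _↔_; _⇔_; mk⇔; mk↔ₛ′; Equivalence; Inverse)
open import Function.Properties.Inverse using (↔-refl; ↔-sym; ↔-trans)
open import Level using (0ℓ)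
open import Relation.Nullary using (¬_; Dec; yes; no)
open import Relation.Nullary.Decidable using (⌊_⌋; _⊎-dec_; toWitness; fromWitness; toWitnessFalse; fromWitnessFalse)
open import Relation.Binary.Definitions using (tri<; tri≈; tri>)
open import Relation.Binary.PropositionalEquality
open import Defs
open FiniteDifferences using (Δ; Δ-binomial; rhs≡binomialTransform)

abstract
  punchIn : ℕ → ℕ → ℕ
  punchIn c p with p <? c
  ... | yes _ = p
  ... | no  _ = suc p

  punchOut : ℕ → ℕ → ℕ
  punchOut c q with q <? c
  ... | yes _ = q
  ... | no  _ = pred q

  punchIn-< : ∀ {c p} → p < c → punchIn c p ≡ p
  punchIn-< {c} {p} p<c with p <? c
  ... | yes _   = refl
  ... | no  p≮c = ⊥-elim (p≮c p<c)

  punchIn-≥ : ∀ {c p} → c ≤ p → punchIn c p ≡ suc p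
  punchIn-≥ {c} {p} c≤p with p <? c
  ... | yes p<c = ⊥-elim (<⇒≱ p<c c≤p)
  ... | no  _   = refl

  punchOut-< : ∀ {c q} → q < c → punchOut c q ≡ q
  punchOut-< {c} {q} q<c with q <? c
  ... | yes _   = refl
  ... | no  q≮c = ⊥-elim (q≮c q<c)

  punchOut-> : ∀ {c q} → c < q → punchOut c q ≡ pred q
  punchOut-> {c} {q} c<q with q <? c
  ... | yes q<c = ⊥-elim (<-asym q<c c<q)
  ... | no  _   = refl

  punchInᶜ≢c : ∀ c p → punchIn c p ≢ c
  punchInᶜ≢c c p with p <? c
  ... | yes p<c = λ p≡c → <-irrefl p≡c p<c
  ... | no  p≮c = λ 1+p≡c → p≮c (≤-reflexive 1+p≡c)

  punchOut-punchIn : ∀ c p → punchOut c (punchIn c p) ≡ p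
  punchOut-punchIn c p with p <? c
  ... | yes p<c = punchOut-< p<c
  ... | no  p≮c = punchOut-> (s≤s (≮⇒≥ p≮c))

  punchIn-punchOut : ∀ {c q} → q ≢ c → punchIn c (punchOut c q) ≡ q
  punchIn-punchOut {c} {q} q≢c with <-cmp q c
  ... | tri< q<c _ _ = trans (cong (punchIn c) (punchOut-< q<c)) (punchIn-< q<c)
  ... | tri≈ _ q≡c _ = ⊥-elim (q≢c q≡c)
  punchIn-punchOut {c} {suc q} _ | tri> _ _ c<q =
    trans (cong (punchIn c) (punchOut-> c<q)) (punchIn-≥ (≤-pred c<q))

  punchIn-≤ : ∀ c p → punchIn c p ≤ suc p
  punchIn-≤ c p with p <? c
  ... | yes _ = n≤1+n p
  ... | no  _ = ≤-refl

  punchIn-mono-< : ∀ c {p q} → p < q → punchIn c p < punchIn c q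
  punchIn-mono-< c {p} {q} p<q with p <? c | q <? c
  ... | yes _   | yes _   = p<q
  ... | yes _   | no  _   = m<n⇒m<1+n p<q
  ... | no  p≮c | yes q<c = ⊥-elim (p≮c (<-trans p<q q<c))
  ... | no  _   | no  _   = s≤s p<q

  punchIn-cancel-< : ∀ c {p q} → punchIn c p < punchIn c q → p < q
  punchIn-cancel-< c {p} {q} lt with <-cmp p q
  ... | tri< p<q _ _ = p<q
  ... | tri≈ _ refl _ = ⊥-elim (<-irrefl refl lt)
  ... | tri> _ _ q<p = ⊥-elim (<-asym lt (punchIn-mono-< c q<p))

-- For a < b, punchIn₂ a b enumerates ℕ ∖ {a, b} in increasing order.
punchIn₂ : ℕ → ℕ → ℕ → ℕ
punchIn₂ a b p = punchIn b (punchIn a p)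

punchOut₂ : ℕ → ℕ → ℕ → ℕ
punchOut₂ a b q = punchOut a (punchOut b q)

module _ {a b : ℕ} (a<b : a < b) where

  punchIn₂-< : ∀ {p} → p < a → punchIn₂ a b p ≡ p
  punchIn₂-< p<a = trans (cong (punchIn b) (punchIn-< p<a)) (punchIn-< (<-trans p<a a<b))

  punchIn₂-mid : ∀ {p} → a ≤ p → suc p < b → punchIn₂ a b p ≡ suc p
  punchIn₂-mid a≤p 1+p<b = trans (cong (punchIn b) (punchIn-≥ a≤p)) (punchIn-< 1+p<b)

  punchIn₂-> : ∀ {p} → b ≤ suc p → punchIn₂ a b p ≡ suc (suc p)
  punchIn₂-> b≤1+p =
    trans (cong (punchIn b) (punchIn-≥ (≤-pred (≤-trans a<b b≤1+p)))) (punchIn-≥ b≤1+p)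

  punchIn₂≢a : ∀ p → punchIn₂ a b p ≢ a
  punchIn₂≢a p eq with punchIn a p <? b
  ... | yes x<b = punchInᶜ≢c a p (trans (sym (punchIn-< x<b)) eq)
  ... | no  x≮b = <-asym a<b (subst (b <_) (trans (sym (punchIn-≥ (≮⇒≥ x≮b))) eq) (s≤s (≮⇒≥ x≮b)))

  punchIn₂≢b : ∀ p → punchIn₂ a b p ≢ b
  punchIn₂≢b p = punchInᶜ≢c b (punchIn a p)

  punchOut₂-punchIn₂ : ∀ p → punchOut₂ a b (punchIn₂ a b p) ≡ p
  punchOut₂-punchIn₂ p = trans (cong (punchOut a) (punchOut-punchIn b (punchIn a p))) (punchOut-punchIn a p)

  punchIn₂-punchOut₂ : ∀ {q} → q ≢ a → q ≢ b → punchIn₂ a b (punchOut₂ a b q) ≡ q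
  punchIn₂-punchOut₂ {q} q≢a q≢b =
    trans (cong (punchIn b) (punchIn-punchOut x≢a)) (punchIn-punchOut q≢b)
    where
    x≢a : punchOut b q ≢ a
    x≢a x≡a = q≢a (trans (sym (punchIn-punchOut q≢b)) (trans (cong (punchIn b) x≡a) (punchIn-< a<b)))

  punchIn₂-injective : ∀ {p q} → punchIn₂ a b p ≡ punchIn₂ a b q → p ≡ q
  punchIn₂-injective {p} {q} eq =
    trans (sym (punchOut₂-punchIn₂ p)) (trans (cong (punchOut₂ a b) eq) (punchOut₂-punchIn₂ q))

  punchIn₂-mono-< : ∀ {p q} → p < q → punchIn₂ a b p < punchIn₂ a b q
  punchIn₂-mono-< p<q = punchIn-mono-< b (punchIn-mono-< a p<q)

  punchIn₂-cancel-< : ∀ {p q} → punchIn₂ a b p < punchIn₂ a b q → p < q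
  punchIn₂-cancel-< lt = punchIn-cancel-< a (punchIn-cancel-< b lt)

  punchIn₂-suc : ∀ p → suc (punchIn₂ a b p) ≢ a → suc (punchIn₂ a b p) ≢ b →
                 punchIn₂ a b (suc p) ≡ suc (punchIn₂ a b p)
  punchIn₂-suc p ≢a ≢b with <-cmp (suc p) a
  ... | tri< 1+p<a _ _ = trans (punchIn₂-< 1+p<a) (cong suc (sym (punchIn₂-< (<-trans (n<1+n p) 1+p<a))))
  ... | tri≈ _ 1+p≡a _ = ⊥-elim (≢a (trans (cong suc (punchIn₂-< (≤-reflexive 1+p≡a))) 1+p≡a))
  ... | tri> _ _ a<1+p with <-cmp (suc (suc p)) b
  ...   | tri< 2+p<b _ _ = trans (punchIn₂-mid (≤-trans (n≤1+n a) a<1+p) 2+p<b)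
                                 (cong suc (sym (punchIn₂-mid (≤-pred a<1+p) (<-trans (n<1+n _) 2+p<b))))
  ...   | tri≈ _ 2+p≡b _ =
          ⊥-elim (≢b (trans (cong suc (punchIn₂-mid (≤-pred a<1+p) (≤-reflexive 2+p≡b))) 2+p≡b))
  ...   | tri> _ _ b<2+p = trans (punchIn₂-> (<⇒≤ b<2+p)) (cong suc (sym (punchIn₂-> (≤-pred b<2+p))))

  punchIn₂-<-bound : ∀ {K p} → p < K → punchIn₂ a b p < 2 + K
  punchIn₂-<-bound {K} {p} p<K = s≤s (≤-trans (punchIn-≤ b (punchIn a p)) (s≤s (≤-trans (punchIn-≤ a p) p<K)))

  punchIn₂-cancel-bound : ∀ {K p} → b < 2 + K → punchIn₂ a b p < 2 + K → p < K
  punchIn₂-cancel-bound {K} {p} b<2+K lt with p <? K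
  ... | yes p<K = p<K
  ... | no  p≮K = ⊥-elim (p≮K (≤-pred (≤-pred (subst (_< 2 + K) (punchIn₂-> b≤1+p) lt))))
    where
    b≤1+p : b ≤ suc p
    b≤1+p = ≤-trans (≤-pred b<2+K) (s≤s (≮⇒≥ p≮K))

bit : Bool → ℕ
bit true  = 1
bit false = 0

countBelow : (ℕ → Bool) → ℕ → ℕ
countBelow P zero    = 0
countBelow P (suc p) = bit (P p) + countBelow P p

module _ (P : ℕ → Bool) where

  countBelow-suc : ∀ {p} → P p ≡ true → countBelow P (suc p) ≡ suc (countBelow P p)
  countBelow-suc {p} eq = cong (λ x → bit x + countBelow P p) eq

  countBelow-mono : ∀ {p q} → p ≤ q → countBelow P p ≤ countBelow P q
  countBelow-mono {p} {q} p≤q with m≤n⇒m<n∨m≡n p≤q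
  ... | inj₂ refl = ≤-refl
  countBelow-mono {p} {suc q} _ | inj₁ p<1+q =
    ≤-trans (countBelow-mono (≤-pred p<1+q)) (m≤n+m (countBelow P q) (bit (P q)))

  countBelow-strict : ∀ {p q} → P p ≡ true → p < q → countBelow P p < countBelow P q
  countBelow-strict Pp p<q = ≤-trans (≤-reflexive (sym (countBelow-suc Pp))) (countBelow-mono p<q)

  countBelow-injective : ∀ {p q} → P p ≡ true → P q ≡ true →
                         countBelow P p ≡ countBelow P q → p ≡ q
  countBelow-injective {p} {q} Pp Pq eq with <-cmp p q
  ... | tri< p<q _ _ = ⊥-elim (<-irrefl eq (countBelow-strict Pp p<q))
  ... | tri≈ _ p≡q _ = p≡q
  ... | tri> _ _ q<p = ⊥-elim (<-irrefl (sym eq) (countBelow-strict Pq q<p))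

  countBelow-surjective : ∀ K {n} → n < countBelow P K →
                          ∃ λ p → p < K × P p ≡ true × countBelow P p ≡ n
  countBelow-surjective (suc K) {n} n<c with n <? countBelow P K
  ... | yes n<c′ = let p , p<K , Pp , eq = countBelow-surjective K n<c′ in p , m<n⇒m<1+n p<K , Pp , eq
  ... | no  n≮c′ with P K in PK
  ...   | true  = K , ≤-refl , PK , ≤-antisym (≮⇒≥ n≮c′) (≤-pred n<c)
  ...   | false = ⊥-elim (n≮c′ n<c)

countBelow-cong : ∀ {P Q} p → (∀ q → q < p → P q ≡ Q q) → countBelow P p ≡ countBelow Q p
countBelow-cong zero    _   = refl
countBelow-cong (suc p) P≗Q =
  cong₂ _+_ (cong bit (P≗Q p ≤-refl)) (countBelow-cong p (λ q q<p → P≗Q q (m<n⇒m<1+n q<p)))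

module _ {P Q : ℕ → Bool} {c : ℕ} (Q∘punchIn≗P : ∀ p → Q (punchIn c p) ≡ P p) where

  countBelow-punchIn-≤ : ∀ p → p ≤ c → countBelow Q p ≡ countBelow P p
  countBelow-punchIn-≤ p p≤c = countBelow-cong p (λ q q<p →
    trans (cong Q (sym (punchIn-< (<-≤-trans q<p p≤c)))) (Q∘punchIn≗P q))

  countBelow-punchIn-≥ : ∀ p → c ≤ p → countBelow Q (suc p) ≡ bit (Q c) + countBelow P p
  countBelow-punchIn-≥ p c≤p with <-cmp c p
  ... | tri≈ _ refl _ = cong (λ x → bit (Q c) + x) (countBelow-punchIn-≤ c ≤-refl)
  ... | tri> _ _ p<c = ⊥-elim (<⇒≱ p<c c≤p)
  countBelow-punchIn-≥ (suc p) _ | tri< c<1+p _ _ = begin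
      bit (Q (suc p)) + countBelow Q (suc p)
    ≡⟨ cong₂ _+_ (cong bit (trans (cong Q (sym (punchIn-≥ c≤p))) (Q∘punchIn≗P p)))
                 (countBelow-punchIn-≥ p c≤p) ⟩
      bit (P p) + (bit (Q c) + countBelow P p)
    ≡⟨ x∙yz≈y∙xz (bit (P p)) (bit (Q c)) (countBelow P p) ⟩
      bit (Q c) + (bit (P p) + countBelow P p) ∎
    where
    open ≡-Reasoning
    c≤p = ≤-pred c<1+p

-- Matchings as involutions on ℕ

-- Only the values of f below K matter.
record Matching (K : ℕ) (f : ℕ → ℕ) : Set where
  field
    closed      : ∀ {p} → p < K → f p < K
    no-fixpoint : ∀ {p} → p < K → f p ≢ p
    involutive  : ∀ {p} → p < K → f (f p) ≡ p

open Matching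

Matching-cong : ∀ {K f g} → (∀ {p} → p < K → f p ≡ g p) → Matching K f → Matching K g
Matching-cong {K} {f} {g} f≗g M = record
  { closed      = λ p<K → subst (_< K) (f≗g p<K) (closed M p<K)
  ; no-fixpoint = λ p<K eq → no-fixpoint M p<K (trans (f≗g p<K) eq)
  ; involutive  = λ {p} p<K → trans (sym (f≗g (subst (_< K) (f≗g p<K) (closed M p<K))))
                                    (trans (cong f (sym (f≗g p<K))) (involutive M p<K))
  }

-- insertArc a b f adds the arc {a, b} to f, renumbering the old points by punchIn₂ a b.
abstract
  insertArc : ℕ → ℕ → (ℕ → ℕ) → ℕ → ℕ
  insertArc a b f q with q ≟ a | q ≟ b
  ... | yes _ | _     = b
  ... | no  _ | yes _ = a
  ... | no  _ | no  _ = punchIn₂ a b (f (punchOut₂ a b q))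

  insertArc-left : ∀ a b f → insertArc a b f a ≡ b
  insertArc-left a b f with a ≟ a
  ... | yes _   = refl
  ... | no  a≢a = ⊥-elim (a≢a refl)

  insertArc-right : ∀ {a b} f → a ≢ b → insertArc a b f b ≡ a
  insertArc-right {a} {b} f a≢b with b ≟ a | b ≟ b
  ... | yes b≡a | _       = ⊥-elim (a≢b (sym b≡a))
  ... | no  _   | yes _   = refl
  ... | no  _   | no  b≢b = ⊥-elim (b≢b refl)

  insertArc-other : ∀ {a b} f {q} → q ≢ a → q ≢ b → insertArc a b f q ≡ punchIn₂ a b (f (punchOut₂ a b q))
  insertArc-other {a} {b} f {q} q≢a q≢b with q ≟ a | q ≟ b
  ... | yes q≡a | _       = ⊥-elim (q≢a q≡a)
  ... | no  _   | yes q≡b = ⊥-elim (q≢b q≡b)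
  ... | no  _   | no  _   = refl

removeArc : ℕ → ℕ → (ℕ → ℕ) → ℕ → ℕ
removeArc a b F p = punchOut₂ a b (F (punchIn₂ a b p))

module _ {a b : ℕ} (a<b : a < b) where

  insertArc-punchIn₂ : ∀ f p → insertArc a b f (punchIn₂ a b p) ≡ punchIn₂ a b (f p)
  insertArc-punchIn₂ f p =
    trans (insertArc-other f (punchIn₂≢a a<b p) (punchIn₂≢b a<b p))
          (cong (punchIn₂ a b ∘′ f) (punchOut₂-punchIn₂ a<b p))

  removeArc-insertArc : ∀ f p → removeArc a b (insertArc a b f) p ≡ f p
  removeArc-insertArc f p = trans (cong (punchOut₂ a b) (insertArc-punchIn₂ f p)) (punchOut₂-punchIn₂ a<b (f p))

  module _ {K : ℕ} (b<2+K : b < 2 + K) where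

    punchOut₂-bound : ∀ {q} → q < 2 + K → q ≢ a → q ≢ b → punchOut₂ a b q < K
    punchOut₂-bound q<2+K q≢a q≢b =
      punchIn₂-cancel-bound a<b b<2+K (subst (_< 2 + K) (sym (punchIn₂-punchOut₂ a<b q≢a q≢b)) q<2+K)

    Matching-insertArc : ∀ {f} → Matching K f → Matching (2 + K) (insertArc a b f)
    Matching-insertArc {f} M = record
      { closed = λ q<2+K → proj₁ (at q<2+K)
      ; no-fixpoint = λ q<2+K → proj₁ (proj₂ (at q<2+K))
      ; involutive = λ q<2+K → proj₂ (proj₂ (at q<2+K))
      }
      where
      F = insertArc a b f
      a≢b : a ≢ b
      a≢b = <⇒≢ a<b
      at : ∀ {q} → q < 2 + K → F q < 2 + K × F q ≢ q × F (F q) ≡ q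
      at {q} q<2+K with q ≟ a | q ≟ b
      ... | yes refl | _ = subst (_< 2 + K) (sym (insertArc-left a b f)) b<2+K
                         , (λ eq → a≢b (trans (sym eq) (insertArc-left a b f)))
                         , trans (cong F (insertArc-left a b f)) (insertArc-right f a≢b)
      ... | no _ | yes refl = subst (_< 2 + K) (sym (insertArc-right f a≢b)) (<-trans a<b b<2+K)
                            , (λ eq → a≢b (trans (sym (insertArc-right f a≢b)) eq))
                            , trans (cong F (insertArc-right f a≢b)) (insertArc-left a b f)
      ... | no q≢a | no q≢b =
          subst (_< 2 + K) (sym eq) (punchIn₂-<-bound a<b (closed M p<K))
        , (λ Fq≡q → no-fixpoint M p<K (punchIn₂-injective a<b (trans (sym eq) (trans Fq≡q q≡σp))))
        , (begin
            F (F q)                        ≡⟨ cong F eq ⟩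
            F (punchIn₂ a b (f p))         ≡⟨ insertArc-punchIn₂ f (f p) ⟩
            punchIn₂ a b (f (f p))         ≡⟨ cong (punchIn₂ a b) (involutive M p<K) ⟩
            punchIn₂ a b p                 ≡⟨ q≡σp ⟨
            q ∎)
        where
        open ≡-Reasoning
        p = punchOut₂ a b q
        p<K = punchOut₂-bound q<2+K q≢a q≢b
        q≡σp : q ≡ punchIn₂ a b p
        q≡σp = sym (punchIn₂-punchOut₂ a<b q≢a q≢b)
        eq : F q ≡ punchIn₂ a b (f p)
        eq = insertArc-other f q≢a q≢b

    insertArc-cong : ∀ {f g} → (∀ {p} → p < K → f p ≡ g p) →
                     ∀ {q} → q < 2 + K → insertArc a b f q ≡ insertArc a b g q
    insertArc-cong {f} {g} f≗g {q} q<2+K with q ≟ a | q ≟ b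
    ... | yes refl | _ = trans (insertArc-left a b f) (sym (insertArc-left a b g))
    ... | no _ | yes refl = trans (insertArc-right f (<⇒≢ a<b)) (sym (insertArc-right g (<⇒≢ a<b)))
    ... | no q≢a | no q≢b =
      trans (insertArc-other f q≢a q≢b)
            (trans (cong (punchIn₂ a b) (f≗g (punchOut₂-bound q<2+K q≢a q≢b)))
                   (sym (insertArc-other g q≢a q≢b)))

    module _ {F : ℕ → ℕ} (M : Matching (2 + K) F) (Fa≡b : F a ≡ b) where

      private
        Fb≡a : F b ≡ a
        Fb≡a = trans (cong F (sym Fa≡b)) (involutive M (<-trans a<b b<2+K))

        ≢b⇒F≢a : ∀ {q} → q < 2 + K → q ≢ b → F q ≢ a
        ≢b⇒F≢a q<2+K q≢b Fq≡a = q≢b (trans (sym (involutive M q<2+K)) (trans (cong F Fq≡a) Fa≡b))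

        ≢a⇒F≢b : ∀ {q} → q < 2 + K → q ≢ a → F q ≢ b
        ≢a⇒F≢b q<2+K q≢a Fq≡b = q≢a (trans (sym (involutive M q<2+K)) (trans (cong F Fq≡b) Fb≡a))

      punchIn₂-removeArc : ∀ {p} → p < K → punchIn₂ a b (removeArc a b F p) ≡ F (punchIn₂ a b p)
      punchIn₂-removeArc {p} p<K = punchIn₂-punchOut₂ a<b
        (≢b⇒F≢a σp<2+K (punchIn₂≢b a<b p)) (≢a⇒F≢b σp<2+K (punchIn₂≢a a<b p))
        where σp<2+K = punchIn₂-<-bound a<b p<K

      Matching-removeArc : Matching K (removeArc a b F)
      Matching-removeArc = record
        { closed = λ {p} p<K → punchIn₂-cancel-bound a<b b<2+K
            (subst (_< 2 + K) (sym (punchIn₂-removeArc p<K)) (closed M (punchIn₂-<-bound a<b p<K)))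
        ; no-fixpoint = λ {p} p<K eq → no-fixpoint M (punchIn₂-<-bound a<b p<K)
            (trans (sym (punchIn₂-removeArc p<K)) (cong (punchIn₂ a b) eq))
        ; involutive = λ {p} p<K → begin
            punchOut₂ a b (F (punchIn₂ a b (removeArc a b F p)))
              ≡⟨ cong (punchOut₂ a b ∘ F) (punchIn₂-removeArc p<K) ⟩
            punchOut₂ a b (F (F (punchIn₂ a b p)))
              ≡⟨ cong (punchOut₂ a b) (involutive M (punchIn₂-<-bound a<b p<K)) ⟩
            punchOut₂ a b (punchIn₂ a b p)
              ≡⟨ punchOut₂-punchIn₂ a<b p ⟩
            p ∎
        }
        where open ≡-Reasoning

      insertArc-removeArc : ∀ {q} → q < 2 + K → insertArc a b (removeArc a b F) q ≡ F q
      insertArc-removeArc {q} q<2+K with q ≟ a | q ≟ b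
      ... | yes refl | _ = trans (insertArc-left a b _) (sym Fa≡b)
      ... | no _ | yes refl = trans (insertArc-right _ (<⇒≢ a<b)) (sym Fb≡a)
      ... | no q≢a | no q≢b = begin
          insertArc a b (removeArc a b F) q
            ≡⟨ insertArc-other _ q≢a q≢b ⟩
          punchIn₂ a b (removeArc a b F (punchOut₂ a b q))
            ≡⟨ punchIn₂-removeArc (punchOut₂-bound q<2+K q≢a q≢b) ⟩
          F (punchIn₂ a b (punchOut₂ a b q))
            ≡⟨ cong F (punchIn₂-punchOut₂ a<b q≢a q≢b) ⟩
          F q ∎
        where open ≡-Reasoning

isOpener : (ℕ → ℕ) → ℕ → Bool
isOpener f q = q <ᵇ f q

rank : (ℕ → ℕ) → ℕ → ℕ
rank f = countBelow (isOpener f)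

isOpener-intro : ∀ {f q} → q < f q → isOpener f q ≡ true
isOpener-intro q<fq = Equivalence.to T-≡ (<⇒<ᵇ q<fq)

isOpener-elim : ∀ {f q} → isOpener f q ≡ true → q < f q
isOpener-elim {f} {q} eq = <ᵇ⇒< q (f q) (Equivalence.from T-≡ eq)

isOpener-cong : ∀ {f q g q′} → (q < f q → q′ < g q′) → (q′ < g q′ → q < f q) →
                isOpener f q ≡ isOpener g q′
isOpener-cong {f} {q} {g} {q′} to from with isOpener f q in e₁ | isOpener g q′ in e₂
... | true  | true  = refl
... | false | false = refl
... | true  | false = case trans (sym (isOpener-intro {g} (to (isOpener-elim {f} e₁)))) e₂ of λ ()
... | false | true  = case trans (sym (isOpener-intro {f} (from (isOpener-elim {g} e₂)))) e₁ of λ ()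

isOpener-false : ∀ {f q} → f q < q → isOpener f q ≡ false
isOpener-false {f} {q} fq<q with isOpener f q in e
... | true  = ⊥-elim (<-asym fq<q (isOpener-elim {f} e))
... | false = refl

rank-suc : ∀ {f q} → q < f q → rank f (suc q) ≡ suc (rank f q)
rank-suc {f} q<fq = countBelow-suc (isOpener f) (isOpener-intro {f} q<fq)

rank-cong : ∀ {K f g} → (∀ {q} → q < K → f q ≡ g q) → ∀ {p} → p ≤ K → rank f p ≡ rank g p
rank-cong f≗g {p} p≤K = countBelow-cong p (λ q q<p → cong (q <ᵇ_) (f≗g (<-≤-trans q<p p≤K)))

module _ {a b : ℕ} (a<b : a < b) (f : ℕ → ℕ) where
  private
    F = insertArc a b f
    Q : ℕ → Bool
    Q = isOpener F ∘ punchIn b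

    Q∘punchIn≗isOpener : ∀ p → Q (punchIn a p) ≡ isOpener f p
    Q∘punchIn≗isOpener p = isOpener-cong {F} {punchIn₂ a b p} {f} {p}
      (λ lt → punchIn₂-cancel-< a<b (subst (punchIn₂ a b p <_) (insertArc-punchIn₂ a<b f p) lt))
      (λ lt → subst (punchIn₂ a b p <_) (sym (insertArc-punchIn₂ a<b f p)) (punchIn₂-mono-< a<b lt))

    rank-punchIn : ∀ x → rank F (punchIn b x) ≡ countBelow Q x
    rank-punchIn x with x <? b
    ... | yes x<b = trans (cong (rank F) (punchIn-< x<b)) (countBelow-punchIn-≤ (λ _ → refl) x (<⇒≤ x<b))
    ... | no  x≮b = begin
        rank F (punchIn b x)              ≡⟨ cong (rank F) (punchIn-≥ (≮⇒≥ x≮b)) ⟩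
        rank F (suc x)                    ≡⟨ countBelow-punchIn-≥ (λ _ → refl) x (≮⇒≥ x≮b) ⟩
        bit (isOpener F b) + countBelow Q x ≡⟨ cong (λ o → bit o + countBelow Q x) b-closes ⟩
        countBelow Q x                    ∎
      where
      open ≡-Reasoning
      b-closes : isOpener F b ≡ false
      b-closes = isOpener-false {F} (subst (_< b) (sym (insertArc-right f (<⇒≢ a<b))) a<b)

  rank-insertArc-≤ : ∀ {p} → p ≤ a → rank F p ≡ rank f p
  rank-insertArc-≤ {p} p≤a =
    trans (countBelow-punchIn-≤ (λ _ → refl) p (≤-trans p≤a (<⇒≤ a<b)))
          (countBelow-punchIn-≤ Q∘punchIn≗isOpener p p≤a)

  rank-insertArc-punchIn₂ : ∀ {p} → a ≤ p → rank F (punchIn₂ a b p) ≡ suc (rank f p)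
  rank-insertArc-punchIn₂ {p} a≤p = begin
      rank F (punchIn b (punchIn a p))   ≡⟨ rank-punchIn (punchIn a p) ⟩
      countBelow Q (punchIn a p)         ≡⟨ cong (countBelow Q) (punchIn-≥ a≤p) ⟩
      countBelow Q (suc p)               ≡⟨ countBelow-punchIn-≥ Q∘punchIn≗isOpener p a≤p ⟩
      bit (Q a) + rank f p               ≡⟨ cong (λ o → bit o + rank f p) a-opens ⟩
      suc (rank f p)                     ∎
    where
    open ≡-Reasoning
    a-opens : Q a ≡ true
    a-opens = trans (cong (isOpener F) (punchIn-< a<b))
                    (isOpener-intro {F} (subst (a <_) (sym (insertArc-left a b f)) a<b))

-- Occurrences of 21 and their ranks

record Occurrence (K : ℕ) (f : ℕ → ℕ) (i j : ℕ) : Set where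
  field
    separated : 2 + i ≤ j
    bounded   : 2 + j ≤ K
    outer     : f i ≡ suc j
    inner     : f (suc i) ≡ j

  1+i<j : suc i < j
  1+i<j = separated

  j<K : j < K
  j<K = <-trans (n<1+n j) bounded

  1+i<K : suc i < K
  1+i<K = <-trans 1+i<j j<K

  i<K : i < K
  i<K = <-trans (n<1+n i) 1+i<K

open Occurrence

Occurrence-cong : ∀ {K f g i j} → (∀ {p} → p < K → f p ≡ g p) → Occurrence K f i j → Occurrence K g i j
Occurrence-cong f≗g o = record
  { separated = separated o
  ; bounded   = bounded o
  ; outer     = trans (sym (f≗g (i<K o))) (outer o)
  ; inner     = trans (sym (f≗g (1+i<K o))) (inner o)
  }

HasOccurrence≥ : ℕ → (ℕ → ℕ) → ℕ → Set
HasOccurrence≥ K f n = ∃₂ λ i j → Occurrence K f i j × n ≤ rank f i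

HasOccurrence≥-cong : ∀ {K f g n} → (∀ {p} → p < K → f p ≡ g p) →
                      HasOccurrence≥ K f n → HasOccurrence≥ K g n
HasOccurrence≥-cong f≗g (i , j , o , n≤rank) =
  i , j , Occurrence-cong f≗g o , ≤-trans n≤rank (≤-reflexive (rank-cong f≗g (<⇒≤ (i<K o))))

Touches : ℕ → ℕ → ℕ → Set
Touches i j x = x ≡ i ⊎ x ≡ suc i ⊎ x ≡ j ⊎ x ≡ suc j

touches? : ∀ i j x → Dec (Touches i j x)
touches? i j x = (x ≟ i) ⊎-dec ((x ≟ suc i) ⊎-dec ((x ≟ j) ⊎-dec (x ≟ suc j)))

module _ {K F i j} (M : Matching K F) (o : Occurrence K F i j) where

  touches-partner : ∀ {x} → Touches i j x → Touches i j (F x)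
  touches-partner (inj₁ refl)                = inj₂ (inj₂ (inj₂ (outer o)))
  touches-partner (inj₂ (inj₁ refl))         = inj₂ (inj₂ (inj₁ (inner o)))
  touches-partner (inj₂ (inj₂ (inj₁ refl)))  =
    inj₂ (inj₁ (trans (cong F (sym (inner o))) (involutive M (1+i<K o))))
  touches-partner (inj₂ (inj₂ (inj₂ refl)))  =
    inj₁ (trans (cong F (sym (outer o))) (involutive M (i<K o)))

  touching-arc : ∀ {a b} → a < b → F a ≡ b → Touches i j a →
                 (a ≡ i × b ≡ suc j) ⊎ (a ≡ suc i × b ≡ j)
  touching-arc a<b Fa≡b (inj₁ refl)               = inj₁ (refl , trans (sym Fa≡b) (outer o))
  touching-arc a<b Fa≡b (inj₂ (inj₁ refl))        = inj₂ (refl , trans (sym Fa≡b) (inner o))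
  touching-arc a<b Fa≡b (inj₂ (inj₂ (inj₁ refl))) = ⊥-elim (<-asym a<b (subst (_< j) (sym b≡1+i) (1+i<j o)))
    where
    b≡1+i = trans (sym Fa≡b) (trans (cong F (sym (inner o))) (involutive M (1+i<K o)))
  touching-arc a<b Fa≡b (inj₂ (inj₂ (inj₂ refl))) = ⊥-elim (<-asym a<b (subst (_< suc j) (sym b≡i) i<1+j))
    where
    b≡i = trans (sym Fa≡b) (trans (cong F (sym (outer o))) (involutive M (i<K o)))
    i<1+j = <-trans (n<1+n i) (<-trans (1+i<j o) (n<1+n j))

module _ {a b K : ℕ} {f : ℕ → ℕ} (a<b : a < b) (b<2+K : b < 2 + K) (M : Matching K f) where
  private
    F = insertArc a b f
    σ = punchIn₂ a b
    τ = punchOut₂ a b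

  occurrence-insertArc : ∀ {p q} → Occurrence K f p q →
                         σ (suc p) ≡ suc (σ p) → σ (suc q) ≡ suc (σ q) → Occurrence (2 + K) F (σ p) (σ q)
  occurrence-insertArc {p} {q} o σ[1+p] σ[1+q] = record
    { separated = subst (_< σ q) σ[1+p] (punchIn₂-mono-< a<b (1+i<j o))
    ; bounded   = subst (_< 2 + K) σ[1+q] (punchIn₂-<-bound a<b (bounded o))
    ; outer     = trans (insertArc-punchIn₂ a<b f p) (trans (cong σ (outer o)) σ[1+q])
    ; inner     = trans (cong F (sym σ[1+p])) (trans (insertArc-punchIn₂ a<b f (suc p)) (cong σ (inner o)))
    }

  occurrence-removeArc : ∀ {i j} → Occurrence (2 + K) F i j → ¬ Touches i j a → ¬ Touches i j b →
                         Occurrence K f (τ i) (τ j)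
  occurrence-removeArc {i} {j} o ¬a ¬b = record
    { separated = ≤∧≢⇒< p<q (λ 1+p≡q → no-fixpoint M 1+p<K (trans fσ[1+p] (sym 1+p≡q)))
    ; bounded   = 1+q<K
    ; outer     = punchIn₂-injective a<b (begin
        σ (f p)          ≡⟨ insertArc-punchIn₂ a<b f p ⟨
        F (σ p)          ≡⟨ cong F σp≡i ⟩
        F i              ≡⟨ outer o ⟩
        suc j            ≡⟨ σ[1+q]≡1+j ⟨
        σ (suc q)        ∎)
    ; inner     = fσ[1+p]
    }
    where
    open ≡-Reasoning
    p = τ i
    q = τ j
    σp≡i : σ p ≡ i
    σp≡i = punchIn₂-punchOut₂ a<b (¬a ∘ inj₁ ∘ sym) (¬b ∘ inj₁ ∘ sym)
    σq≡j : σ q ≡ j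
    σq≡j = punchIn₂-punchOut₂ a<b (¬a ∘ inj₂ ∘ inj₂ ∘ inj₁ ∘ sym)
                                  (¬b ∘ inj₂ ∘ inj₂ ∘ inj₁ ∘ sym)
    adjacent : ∀ {x y} → σ x ≡ y → suc y ≢ a → suc y ≢ b → σ (suc x) ≡ suc y
    adjacent {x} refl 1+y≢a 1+y≢b = punchIn₂-suc a<b x 1+y≢a 1+y≢b
    σ[1+p]≡1+i : σ (suc p) ≡ suc i
    σ[1+p]≡1+i = adjacent σp≡i (¬a ∘ inj₂ ∘ inj₁ ∘ sym) (¬b ∘ inj₂ ∘ inj₁ ∘ sym)
    σ[1+q]≡1+j : σ (suc q) ≡ suc j
    σ[1+q]≡1+j = adjacent σq≡j (¬a ∘ inj₂ ∘ inj₂ ∘ inj₂ ∘ sym)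
                               (¬b ∘ inj₂ ∘ inj₂ ∘ inj₂ ∘ sym)
    1+q<K : suc q < K
    1+q<K = punchIn₂-cancel-bound a<b b<2+K (subst (_< 2 + K) (sym σ[1+q]≡1+j) (bounded o))
    p<q : p < q
    p<q = punchIn₂-cancel-< a<b (subst₂ _<_ (sym σp≡i) (sym σq≡j) (<-trans (n<1+n i) (1+i<j o)))
    1+p<K : suc p < K
    1+p<K = <-trans (s≤s p<q) 1+q<K
    fσ[1+p] : f (suc p) ≡ q
    fσ[1+p] = punchIn₂-injective a<b (begin
        σ (f (suc p))    ≡⟨ insertArc-punchIn₂ a<b f (suc p) ⟨
        F (σ (suc p))    ≡⟨ cong F σ[1+p]≡1+i ⟩
        F (suc i)        ≡⟨ inner o ⟩
        j                ≡⟨ σq≡j ⟨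
        σ q              ∎)

  rank-insertArc-punchIn₂-≤ : ∀ p → rank F (σ p) ≤ suc (rank f p)
  rank-insertArc-punchIn₂-≤ p with p <? a
  ... | yes p<a = ≤-trans (≤-reflexive (trans (cong (rank F) (punchIn₂-< a<b p<a))
                                              (rank-insertArc-≤ a<b f (<⇒≤ p<a))))
                          (n≤1+n _)
  ... | no  p≮a = ≤-reflexive (rank-insertArc-punchIn₂ a<b f (≮⇒≥ p≮a))

-- F nests a new arc {l + 1, r + 1} immediately inside the arc {l, r} of rank n.
module Nesting {K l r n : ℕ} {f : ℕ → ℕ} (M : Matching K f) (l<K : l < K) (fl≡r : f l ≡ r) (l<r : l < r)
               (rank-l : rank f l ≡ n) where

  a b : ℕ
  a = suc l
  b = suc r

  a<b : a < b
  a<b = s≤s l<r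

  r<K : r < K
  r<K = subst (_< K) fl≡r (closed M l<K)

  b<2+K : b < 2 + K
  b<2+K = s≤s (<-trans r<K (n<1+n K))

  F : ℕ → ℕ
  F = insertArc a b f

  MF : Matching (2 + K) F
  MF = Matching-insertArc a<b b<2+K M

  private
    σ = punchIn₂ a b

  Fa≡b : F a ≡ b
  Fa≡b = insertArc-left a b f

  Fb≡a : F b ≡ a
  Fb≡a = insertArc-right f (<⇒≢ a<b)

  fr≡l : f r ≡ l
  fr≡l = trans (cong f (sym fl≡r)) (involutive M l<K)

  ≡r⇒≡l : ∀ {x} → x < K → f x ≡ r → x ≡ l
  ≡r⇒≡l x<K fx≡r = trans (sym (involutive M x<K)) (trans (cong f fx≡r) fr≡l)

  σl≡l : σ l ≡ l
  σl≡l = punchIn₂-< a<b (n<1+n l)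

  Fl≡2+r : F l ≡ suc b
  Fl≡2+r = begin
    F l          ≡⟨ cong F σl≡l ⟨
    F (σ l)      ≡⟨ insertArc-punchIn₂ a<b f l ⟩
    σ (f l)      ≡⟨ cong σ fl≡r ⟩
    σ r          ≡⟨ punchIn₂-> a<b ≤-refl ⟩
    suc (suc r)  ∎
    where open ≡-Reasoning

  rank-F-l : rank F l ≡ n
  rank-F-l = trans (rank-insertArc-≤ a<b f (n≤1+n l)) rank-l

  nested-occurrence : Occurrence (2 + K) F l b
  nested-occurrence = record
    { separated = s≤s l<r
    ; bounded   = s≤s (s≤s r<K)
    ; outer     = Fl≡2+r
    ; inner     = Fa≡b
    }

  σ-suc : ∀ {x} → x ≢ l → suc x ≢ r → σ (suc x) ≡ suc (σ x)
  σ-suc {x} x≢l 1+x≢r with <-cmp x l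
  ... | tri< x<l _ _ = trans (punchIn₂-< a<b (s≤s x<l)) (cong suc (sym (punchIn₂-< a<b (m<n⇒m<1+n x<l))))
  ... | tri≈ _ x≡l _ = ⊥-elim (x≢l x≡l)
  ... | tri> _ _ l<x with <-cmp (suc x) r
  ...   | tri< 1+x<r _ _ =
          trans (punchIn₂-mid a<b (m<n⇒m<1+n l<x) (s≤s 1+x<r))
                (cong suc (sym (punchIn₂-mid a<b l<x (s≤s (<⇒≤ 1+x<r)))))
  ...   | tri≈ _ 1+x≡r _ = ⊥-elim (1+x≢r 1+x≡r)
  ...   | tri> _ _ r<1+x =
          trans (punchIn₂-> a<b (m<n⇒m<1+n r<1+x)) (cong suc (sym (punchIn₂-> a<b r<1+x)))

  unique : ∀ {i j} → Occurrence (2 + K) F i j → rank F i ≡ n → i ≡ l × j ≡ b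
  unique {i} {j} o rank-i = i≡l , trans (sym (inner o)) (trans (cong (F ∘ suc) i≡l) Fa≡b)
    where
    i≡l : i ≡ l
    i≡l = countBelow-injective (isOpener F)
            (isOpener-intro {F} (subst (i <_) (sym (outer o)) (<-trans (<-trans (n<1+n i) (1+i<j o)) (n<1+n j))))
            (isOpener-intro {F} (subst (l <_) (sym Fl≡2+r) (<-trans l<r (<-trans (n<1+n r) (n<1+n b)))))
            (trans rank-i (sym rank-F-l))

  l-opener : l < f l
  l-opener = subst (l <_) (sym fl≡r) l<r

  rank-F-a : rank F a ≡ suc n
  rank-F-a = trans (rank-insertArc-≤ a<b f ≤-refl) (trans (rank-suc {f} l-opener) (cong suc rank-l))

  inner-occurrence : ∀ {q} → Occurrence K f l q → Occurrence (2 + K) F a r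
  inner-occurrence {q} o = record
    { separated = subst (2 + a ≤_) (sym r≡1+q) (s≤s (separated o))
    ; bounded   = s≤s (s≤s (<⇒≤ r<K))
    ; outer     = Fa≡b
    ; inner     = begin
        F (suc a)          ≡⟨ cong F σ[1+l] ⟨
        F (σ (suc l))      ≡⟨ insertArc-punchIn₂ a<b f (suc l) ⟩
        σ (f (suc l))      ≡⟨ cong σ (inner o) ⟩
        σ q                ≡⟨ σq ⟩
        r                  ∎
    }
    where
    open ≡-Reasoning
    r≡1+q : r ≡ suc q
    r≡1+q = trans (sym fl≡r) (outer o)
    σ[1+l] : σ (suc l) ≡ suc a
    σ[1+l] = punchIn₂-mid a<b ≤-refl (s≤s (subst (2 + l ≤_) (sym r≡1+q) (m≤n⇒m≤1+n (separated o))))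
    σq : σ q ≡ r
    σq = trans (punchIn₂-mid a<b (≤-trans (n≤1+n _) (separated o))
                                 (subst (suc q <_) (cong suc (sym r≡1+q)) ≤-refl))
               (sym r≡1+q)

  shifted-occurrence : ∀ {p q} → Occurrence K f p q → p ≢ l → Occurrence (2 + K) F (σ p) (σ q)
  shifted-occurrence {p} {q} o p≢l = occurrence-insertArc a<b b<2+K M o (σ-suc p≢l 1+p≢r) (σ-suc q≢l 1+q≢r)
    where
    1+p≢r : suc p ≢ r
    1+p≢r 1+p≡r = <-irrefl (sym q≡l) (<-trans l<r (subst (_< q) 1+p≡r (1+i<j o)))
      where
      q≡l : q ≡ l
      q≡l = trans (sym (inner o)) (trans (cong f 1+p≡r) fr≡l)
    q≢l : q ≢ l
    q≢l q≡l = <-asym l<r (subst (r <_) q≡l (subst (_< q) 1+p≡r (1+i<j o)))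
      where
      1+p≡r : suc p ≡ r
      1+p≡r = trans (sym (involutive M (1+i<K o))) (trans (cong f (trans (inner o) q≡l)) fl≡r)
    1+q≢r : suc q ≢ r
    1+q≢r 1+q≡r = p≢l (≡r⇒≡l (i<K o) (trans (outer o) 1+q≡r))

  shifted-rank : ∀ {p q} → Occurrence K f p q → p ≢ l → n ≤ rank f p → suc n ≤ rank F (σ p)
  shifted-rank {p} {q} o p≢l n≤rank with p <? a
  ... | yes p<a = ⊥-elim (<⇒≱ (subst (rank f p <_) rank-l rank-p<rank-l) n≤rank)
    where
    rank-p<rank-l : rank f p < rank f l
    rank-p<rank-l = countBelow-strict (isOpener f)
      (isOpener-intro {f} (subst (p <_) (sym (outer o)) (<-trans (n<1+n p) (<-trans (1+i<j o) (n<1+n q)))))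
      (≤∧≢⇒< (≤-pred p<a) p≢l)
  ... | no  p≮a = ≤-trans (s≤s n≤rank) (≤-reflexive (sym (rank-insertArc-punchIn₂ a<b f (≮⇒≥ p≮a))))

  lift : HasOccurrence≥ K f n → HasOccurrence≥ (2 + K) F (suc n)
  lift (p , q , o , n≤rank) with p ≟ l
  ... | yes refl = a , r , inner-occurrence o , ≤-reflexive (sym rank-F-a)
  ... | no  p≢l  = σ p , σ q , shifted-occurrence o p≢l , shifted-rank o p≢l n≤rank

  outer-occurrence : ∀ {j} → Occurrence (2 + K) F a j → Occurrence K f l (pred r)
  outer-occurrence {j} o = record
    { separated = ≤-pred (subst (3 + l ≤_) (sym 1+r′≡r) 3+l≤r)
    ; bounded   = subst (_< K) (sym 1+r′≡r) r<K
    ; outer     = trans fl≡r (sym 1+r′≡r)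
    ; inner     = punchIn₂-injective a<b (begin
        σ (f (suc l))   ≡⟨ insertArc-punchIn₂ a<b f (suc l) ⟨
        F (σ (suc l))   ≡⟨ cong F σ[1+l] ⟩
        F (suc a)       ≡⟨ inner o ⟩
        j               ≡⟨ r≡j ⟨
        r               ≡⟨ σr′ ⟨
        σ (pred r)      ∎)
    }
    where
    open ≡-Reasoning
    r≡j : r ≡ j
    r≡j = suc-injective (trans (sym Fa≡b) (outer o))
    1+r′≡r : suc (pred r) ≡ r
    1+r′≡r = suc-pred r {{>-nonZero (<-≤-trans (s≤s z≤n) l<r)}}
    3+l≤r : 3 + l ≤ r
    3+l≤r = subst (3 + l ≤_) (sym r≡j) (separated o)
    σ[1+l] : σ (suc l) ≡ suc a
    σ[1+l] = punchIn₂-mid a<b ≤-refl (s≤s (≤-trans (n≤1+n _) 3+l≤r))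
    σr′ : σ (pred r) ≡ r
    σr′ = trans (punchIn₂-mid a<b (≤-pred (subst (2 + l ≤_) (sym 1+r′≡r) (≤-trans (n≤1+n _) 3+l≤r)))
                             (subst (_< b) (sym 1+r′≡r) ≤-refl))
                1+r′≡r

  lower : HasOccurrence≥ (2 + K) F (suc n) → HasOccurrence≥ K f n
  lower (i , j , o , 1+n≤rank) with touches? i j a
  ... | yes touches-a with touching-arc MF o a<b Fa≡b touches-a
  ...   | inj₁ (refl , _) = l , pred r , outer-occurrence o , ≤-reflexive (sym rank-l)
  ...   | inj₂ (refl , _) = ⊥-elim (<-irrefl (sym rank-F-l) 1+n≤rank)
  lower (i , j , o , 1+n≤rank) | no ¬touches-a =
    τi , punchOut₂ a b j , occurrence-removeArc a<b b<2+K M o ¬touches-a ¬touches-b ,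
    ≤-pred (≤-trans 1+n≤rank (subst (λ x → rank F x ≤ suc (rank f τi)) στi≡i
                                    (rank-insertArc-punchIn₂-≤ a<b b<2+K M τi)))
    where
    τi = punchOut₂ a b i
    ¬touches-b : ¬ Touches i j b
    ¬touches-b touches-b = ¬touches-a (subst (Touches i j) Fb≡a (touches-partner MF o touches-b))
    στi≡i : σ τi ≡ i
    στi≡i = punchIn₂-punchOut₂ a<b (¬touches-a ∘ inj₁ ∘ sym) (¬touches-b ∘ inj₁ ∘ sym)

module FirstArc {K : ℕ} {F : ℕ → ℕ} (M : Matching (2 + K) F) where

  b : ℕ
  b = F 0

  0<b : 0 < b
  0<b = ≤∧≢⇒< z≤n (no-fixpoint M (s≤s z≤n) ∘ sym)

  b<2+K : b < 2 + K
  b<2+K = closed M (s≤s z≤n)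

  f : ℕ → ℕ
  f = removeArc 0 b F

  Mf : Matching K f
  Mf = Matching-removeArc 0<b b<2+K M refl

  insertArc-f : ∀ {q} → q < 2 + K → insertArc 0 b f q ≡ F q
  insertArc-f = insertArc-removeArc 0<b b<2+K M refl

2*suc : ∀ N → 2 * suc N ≡ 2 + 2 * N
2*suc N = *-suc 2 N

rank-total : ∀ N {F} → Matching (2 * N) F → rank F (2 * N) ≡ N
rank-total zero    M = refl
rank-total (suc N) {F} M = begin
    rank F (2 * suc N)                   ≡⟨ cong (rank F) (2*suc N) ⟩
    rank F (2 + 2 * N)                   ≡⟨ rank-cong insertArc-f ≤-refl ⟨
    rank (insertArc 0 b f) (2 + 2 * N)   ≡⟨ cong (rank (insertArc 0 b f)) (punchIn₂-> 0<b (≤-pred b<2+K)) ⟨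
    rank (insertArc 0 b f) (punchIn₂ 0 b (2 * N)) ≡⟨ rank-insertArc-punchIn₂ 0<b f z≤n ⟩
    suc (rank f (2 * N))                 ≡⟨ cong suc (rank-total N Mf) ⟩
    suc N                                ∎
  where
  open ≡-Reasoning
  open FirstArc (subst (λ K → Matching K F) (2*suc N) M)

rank-surjective : ∀ N {f n} → Matching (2 * N) f → n < N → ∃ λ l → l < 2 * N × l < f l × rank f l ≡ n
rank-surjective N {f} M n<N with countBelow-surjective (isOpener f) (2 * N) (subst (_ <_) (sym (rank-total N M)) n<N)
... | l , l<2N , opener , rank≡n = l , l<2N , isOpener-elim {f} opener , rank≡n

no-occurrence-at-top-rank : ∀ N {f} → Matching (2 * suc N) f → ¬ HasOccurrence≥ (2 * suc N) f N
no-occurrence-at-top-rank N {f} M (i , j , o , N≤rank) = <-irrefl refl (begin-strict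
    suc N                 <⟨ s≤s (s≤s N≤rank) ⟩
    suc (suc (rank f i))  ≡⟨ cong suc (rank-suc {f} i-opener) ⟨
    suc (rank f (suc i))  ≡⟨ rank-suc {f} 1+i-opener ⟨
    rank f (2 + i)        ≤⟨ countBelow-mono (isOpener f) (≤-trans (separated o) (<⇒≤ (j<K o))) ⟩
    rank f (2 * suc N)    ≡⟨ rank-total (suc N) M ⟩
    suc N                 ∎)
  where
  open ≤-Reasoning
  i-opener : i < f i
  i-opener = subst (i <_) (sym (outer o)) (<-trans (n<1+n i) (<-trans (1+i<j o) (n<1+n j)))
  1+i-opener : suc i < f (suc i)
  1+i-opener = subst (suc i <_) (sym (inner o)) (1+i<j o)

-- Cancelling summands of finite types

module _ {X Y : Set} (f : ⊤ ⊎ X → ⊤ ⊎ Y) (f-injective : ∀ {u v} → f u ≡ f v → u ≡ v) where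

  private
    skip′ : ∀ x (u : ⊤ ⊎ Y) → f (inj₂ x) ≡ u → (w : ⊤ ⊎ Y) → f (inj₁ tt) ≡ w → Y
    skip′ x (inj₂ y) _ _        _ = y
    skip′ x (inj₁ _) _ (inj₂ y) _ = y
    skip′ x (inj₁ _) p (inj₁ _) q with () ← f-injective (trans p (sym q))

  skip : X → Y
  skip x = skip′ x (f (inj₂ x)) refl (f (inj₁ tt)) refl

  SkipSpec : X → Y → Set
  SkipSpec x y = f (inj₂ x) ≡ inj₂ y ⊎ (f (inj₂ x) ≡ inj₁ tt × f (inj₁ tt) ≡ inj₂ y)

  skip-spec : ∀ x → SkipSpec x (skip x)
  skip-spec x = go (f (inj₂ x)) refl (f (inj₁ tt)) refl
    where
    go : ∀ u (p : f (inj₂ x) ≡ u) w (q : f (inj₁ tt) ≡ w) → SkipSpec x (skip′ x u p w q)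
    go (inj₂ y) p _        _ = inj₁ p
    go (inj₁ _) p (inj₂ y) q = inj₂ (p , q)
    go (inj₁ _) p (inj₁ _) q with () ← f-injective (trans p (sym q))

module _ {X Y : Set} (f : ⊤ ⊎ X → ⊤ ⊎ Y) (g : ⊤ ⊎ Y → ⊤ ⊎ X)
         (f-inj : ∀ {u v} → f u ≡ f v → u ≡ v) (g-inj : ∀ {u v} → g u ≡ g v → u ≡ v)
         (g∘f : ∀ u → g (f u) ≡ u) where

  private
    undo : ∀ {u v} → f u ≡ v → g v ≡ u
    undo {u} refl = g∘f u

  skip-inverse : ∀ x → skip g g-inj (skip f f-inj x) ≡ x
  skip-inverse x with skip-spec f f-inj x | skip-spec g g-inj (skip f f-inj x)
  ... | inj₁ fx       | inj₁ gy       = inj₂-injective (trans (sym gy) (undo fx))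
  ... | inj₁ fx       | inj₂ (gy , _) with () ← trans (sym (undo fx)) gy
  ... | inj₂ (_ , f⊤) | inj₁ gy       with () ← trans (sym (undo f⊤)) gy
  ... | inj₂ (fx , _) | inj₂ (_ , g⊤) = inj₂-injective (trans (sym g⊤) (undo fx))

↔-cancelˡ-⊤ : ∀ {X Y : Set} → (⊤ ⊎ X) ↔ (⊤ ⊎ Y) → X ↔ Y
↔-cancelˡ-⊤ e = mk↔ₛ′ (skip to to-injective) (skip from from-injective)
  (skip-inverse from to from-injective to-injective strictlyInverseˡ)
  (skip-inverse to from to-injective from-injective strictlyInverseʳ)
  where
  open Inverse e
  to-injective : ∀ {u v} → to u ≡ to v → u ≡ v
  to-injective {u} {v} eq = trans (sym (strictlyInverseʳ u)) (trans (cong from eq) (strictlyInverseʳ v))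
  from-injective : ∀ {u v} → from u ≡ from v → u ≡ v
  from-injective {u} {v} eq = trans (sym (strictlyInverseˡ u)) (trans (cong to eq) (strictlyInverseˡ v))

Fin-suc↔⊤⊎ : ∀ {n} → Fin (suc n) ↔ (⊤ ⊎ Fin n)
Fin-suc↔⊤⊎ {n} = ↔-trans (+↔⊎ {1} {n}) (⊎-cong 1↔⊤ ↔-refl)

↔-cancelʳ-Fin : ∀ {A : Set} b c → (A ⊎ Fin b) ↔ Fin c → Σ ℕ λ d → (A ↔ Fin d) × (d + b ≡ c)
↔-cancelʳ-Fin {A} zero c e =
  c , ↔-trans A↔A⊎Fin0 e , +-identityʳ c
  where
  A↔A⊎Fin0 : A ↔ (A ⊎ Fin 0)
  A↔A⊎Fin0 = mk↔ₛ′ inj₁ (λ { (inj₁ a) → a ; (inj₂ ()) })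
                        (λ { (inj₁ _) → refl ; (inj₂ ()) }) (λ _ → refl)
↔-cancelʳ-Fin (suc b) zero e with () ← Inverse.to e (inj₂ Fin.zero)
↔-cancelʳ-Fin {A} (suc b) (suc c) e =
  let d , A↔d , d+b≡c = ↔-cancelʳ-Fin b c (↔-cancelˡ-⊤ e′) in d , A↔d , trans (+-suc d b) (cong suc d+b≡c)
  where
  e′ : (⊤ ⊎ (A ⊎ Fin b)) ↔ (⊤ ⊎ Fin c)
  e′ = ↔-trans (↔-sym (⊎-assoc 0ℓ ⊤ A (Fin b)))
      (↔-trans (⊎-cong (⊎-comm ⊤ A) ↔-refl)
      (↔-trans (⊎-assoc 0ℓ A ⊤ (Fin b))
      (↔-trans (⊎-cong ↔-refl (↔-sym Fin-suc↔⊤⊎))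
      (↔-trans e Fin-suc↔⊤⊎))))

open Equivalence

toFun : ∀ {k m} → Vec (Fin k) m → ℕ → ℕ
toFun []      _       = 0
toFun (x ∷ _) zero    = toℕ x
toFun (_ ∷ v) (suc p) = toFun v p

toFun-lookup : ∀ {k m} (v : Vec (Fin k) m) x → toFun v (toℕ x) ≡ toℕ (lookup v x)
toFun-lookup (_ ∷ _) Fin.zero    = refl
toFun-lookup (_ ∷ v) (Fin.suc x) = toFun-lookup v x

toFun-< : ∀ {k m} (v : Vec (Fin k) m) {p} → p < m → toFun v p < k
toFun-< (x ∷ _) {zero}  _         = toℕ<n x
toFun-< (_ ∷ v) {suc p} (s≤s p<m) = toFun-< v p<m

toFun-injective : ∀ {k m} {v w : Vec (Fin k) m} → (∀ {p} → p < m → toFun v p ≡ toFun w p) → v ≡ w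
toFun-injective {v = []}    {[]}    _    = refl
toFun-injective {v = x ∷ v} {y ∷ w} v≗w =
  cong₂ _∷_ (toℕ-injective (v≗w (s≤s z≤n))) (toFun-injective (v≗w ∘ s≤s))

fromFun : ∀ {k m} (h : ℕ → ℕ) → (∀ {p} → p < m → h p < k) → Vec (Fin k) m
fromFun h h< = tabulate (λ x → fromℕ< (h< (toℕ<n x)))

toFun-fromFun : ∀ {k m} h (h< : ∀ {p} → p < m → h p < k) {p} → p < m → toFun (fromFun h h<) p ≡ h p
toFun-fromFun {m = m} h h< {p} p<m = begin
    toFun (fromFun h h<) p                   ≡⟨ cong (toFun (fromFun h h<)) (toℕ-fromℕ< p<m) ⟨
    toFun (fromFun h h<) (toℕ x)             ≡⟨ toFun-lookup (fromFun h h<) x ⟩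
    toℕ (lookup (fromFun h h<) x)            ≡⟨ cong toℕ (lookup∘tabulate _ x) ⟩
    toℕ (fromℕ< (h< (toℕ<n x)))              ≡⟨ toℕ-fromℕ< (h< (toℕ<n x)) ⟩
    h (toℕ x)                                ≡⟨ cong h (toℕ-fromℕ< p<m) ⟩
    h p                                      ∎
  where
  open ≡-Reasoning
  x = fromℕ< p<m

fromFun-toFun : ∀ {k m} {h} (h< : ∀ {p} → p < m → h p < k) (v : Vec (Fin k) m) →
                (∀ {p} → p < m → h p ≡ toFun v p) → fromFun h h< ≡ v
fromFun-toFun h< v h≗v = toFun-injective (λ p<m → trans (toFun-fromFun _ h< p<m) (h≗v p<m))

T-all-allFin : ∀ {m} (P : Fin m → Bool) → T (all P (allFin m)) ⇔ (∀ x → T (P x))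
T-all-allFin {m} P = mk⇔ (λ t → All.tabulate⁻ (All.all⁺ P (allFin m) t)) (λ h → All.all⁻ P (All.tabulate⁺ h))

T-any-allFin : ∀ {m} (P : Fin m → Bool) → T (any P (allFin m)) ⇔ (∃ λ x → T (P x))
T-any-allFin {m} P = mk⇔ (λ t → Any.tabulate⁻ (Any.any⁻ P (allFin m) t))
                         (λ (x , Px) → Any.any⁺ P (Any.tabulate⁺ x Px))

T-any-upTo : ∀ n (P : ℕ → Bool) → T (any P (upTo n)) ⇔ (∃ λ i → i < n × T (P i))
T-any-upTo n P = mk⇔ (λ t → Any.applyUpTo⁻ (λ i → i) (Any.any⁻ P (upTo n) t))
                     (λ (i , i<n , Pi) → Any.any⁺ P (Any.applyUpTo⁺ (λ i → i) Pi i<n))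

module _ {m} (v : Vec (Fin m) m) where

  private
    toFun-fromℕ< : ∀ {p} (p<m : p < m) → toFun v p ≡ toℕ (lookup v (fromℕ< p<m))
    toFun-fromℕ< p<m = trans (cong (toFun v) (sym (toℕ-fromℕ< p<m))) (toFun-lookup v (fromℕ< p<m))

    toFun-toFun : ∀ x → toFun v (toFun v (toℕ x)) ≡ toℕ (lookup v (lookup v x))
    toFun-toFun x = trans (cong (toFun v) (toFun-lookup v x)) (toFun-lookup v (lookup v x))

  private
    distinct involutive? : Fin m → Bool
    distinct x = not ⌊ lookup v x ≟ᶠ x ⌋
    involutive? x = ⌊ lookup v (lookup v x) ≟ᶠ x ⌋

  isMatching⇔ : T (isMatching v) ⇔ Matching m (toFun v)
  isMatching⇔ = mk⇔ to′ from′
    where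
    to′ : T (isMatching v) → Matching m (toFun v)
    to′ t = record
      { closed      = toFun-< v
      ; no-fixpoint = λ {p} p<m eq → toWitnessFalse (proj₁ (at p<m))
          (toℕ-injective (trans (sym (toFun-fromℕ< p<m)) (trans eq (sym (toℕ-fromℕ< p<m)))))
      ; involutive  = λ {p} p<m → trans (cong (toFun v ∘ toFun v) (sym (toℕ-fromℕ< p<m)))
          (trans (toFun-toFun (fromℕ< p<m)) (trans (cong toℕ (toWitness (proj₂ (at p<m)))) (toℕ-fromℕ< p<m)))
      }
      where
      at : ∀ {p} (p<m : p < m) → T (distinct (fromℕ< p<m)) × T (involutive? (fromℕ< p<m))
      at p<m = to T-∧ (to (T-all-allFin (λ x → distinct x ∧ involutive? x)) t (fromℕ< p<m))
    from′ : Matching m (toFun v) → T (isMatching v)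
    from′ M = from (T-all-allFin (λ x → distinct x ∧ involutive? x)) λ x →
      from (T-∧ {distinct x} {involutive? x})
      ( fromWitnessFalse (λ eq → no-fixpoint M (toℕ<n x) (trans (toFun-lookup v x) (cong toℕ eq)))
      , fromWitness (toℕ-injective (trans (sym (toFun-toFun x)) (involutive M (toℕ<n x)))))

  isArc⇔ : ∀ a c → T (isArc v a c) ⇔ (a < m × toFun v a ≡ c)
  isArc⇔ a c = mk⇔ to′ from′
    where
    at-a at-c : Fin m → Bool
    at-a x = ⌊ toℕ x ≟ a ⌋
    at-c x = ⌊ toℕ (lookup v x) ≟ c ⌋
    to′ : T (isArc v a c) → a < m × toFun v a ≡ c
    to′ t with x , t′ ← to (T-any-allFin (λ x → at-a x ∧ at-c x)) t
          with x≡a , vx≡c ← to (T-∧ {at-a x}) t′ =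
      subst (_< m) (toWitness x≡a) (toℕ<n x) ,
      trans (cong (toFun v) (sym (toWitness x≡a))) (trans (toFun-lookup v x) (toWitness vx≡c))
    from′ : a < m × toFun v a ≡ c → T (isArc v a c)
    from′ (a<m , va≡c) = from (T-any-allFin (λ x → at-a x ∧ at-c x)) (fromℕ< a<m ,
      from (T-∧ {at-a (fromℕ< a<m)})
      (fromWitness (toℕ-fromℕ< a<m) , fromWitness (trans (sym (toFun-fromℕ< a<m)) va≡c)))

T-not⇔¬T : ∀ {b} → T (not b) ⇔ (¬ T b)
T-not⇔¬T {true}  = mk⇔ (λ ()) (λ ¬t → ¬t _)
T-not⇔¬T {false} = mk⇔ (λ _ ()) (λ _ → _)

Code : ℕ → Set
Code N = Vec (Fin (2 * N)) (2 * N)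

module _ {N : ℕ} (v : Code N) where

  occurs21⇔ : ∀ i j → T (occurs21 N v i j) ⇔ Occurrence (2 * N) (toFun v) i j
  occurs21⇔ i j = mk⇔ to′ from′
    where
    to′ : T (occurs21 N v i j) → Occurrence (2 * N) (toFun v) i j
    to′ t =
      let t₁ , t₂₃₄ = to (T-∧ {⌊ i + 2 ≤? j ⌋}) t
          t₂ , t₃₄  = to (T-∧ {⌊ j + 2 ≤? 2 * N ⌋}) t₂₃₄
          t₃ , t₄   = to (T-∧ {isArc v i (j + 1)}) t₃₄
      in record
      { separated = subst (_≤ j) (+-comm i 2) (toWitness t₁)
      ; bounded   = subst (_≤ 2 * N) (+-comm j 2) (toWitness t₂)
      ; outer     = trans (proj₂ (to (isArc⇔ v i (j + 1)) t₃)) (+-comm j 1)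
      ; inner     = trans (cong (toFun v) (+-comm 1 i)) (proj₂ (to (isArc⇔ v (i + 1) j) t₄))
      }
    from′ : Occurrence (2 * N) (toFun v) i j → T (occurs21 N v i j)
    from′ o = from (T-∧ {⌊ i + 2 ≤? j ⌋}) (fromWitness (subst (_≤ j) (+-comm 2 i) (separated o)) ,
              from (T-∧ {⌊ j + 2 ≤? 2 * N ⌋}) (fromWitness (subst (_≤ 2 * N) (+-comm 2 j) (bounded o)) ,
              from (T-∧ {isArc v i (j + 1)})
                (from (isArc⇔ v i (j + 1)) (i<K o , trans (outer o) (+-comm 1 j)) ,
                 from (isArc⇔ v (i + 1) j) (subst (_< 2 * N) (+-comm 1 i) (1+i<K o) ,
                                            trans (cong (toFun v) (+-comm i 1)) (inner o)))))

-- For n = 0 the test n ≤ᵇ _ reduces to true, so Avoid21From N 0 is Avoid21 N by definition.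
hasOccurrence≥ᵇ : ∀ N → ℕ → Code N → Bool
hasOccurrence≥ᵇ N n v =
  any (λ i → any (λ j → (n ≤ᵇ rank (toFun v) i) ∧ occurs21 N v i j) (upTo (2 * N))) (upTo (2 * N))

avoids : ∀ N → ℕ → Code N → Bool
avoids N n v = isMatching v ∧ not (hasOccurrence≥ᵇ N n v)

module _ {N : ℕ} (n : ℕ) (v : Code N) where

  hasOccurrence≥ᵇ⇔ : T (hasOccurrence≥ᵇ N n v) ⇔ HasOccurrence≥ (2 * N) (toFun v) n
  hasOccurrence≥ᵇ⇔ = mk⇔ to′ from′
    where
    P : ℕ → ℕ → Bool
    P i j = (n ≤ᵇ rank (toFun v) i) ∧ occurs21 N v i j
    to′ : T (hasOccurrence≥ᵇ N n v) → HasOccurrence≥ (2 * N) (toFun v) n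
    to′ t =
      let i , _ , tᵢ = to (T-any-upTo (2 * N) (λ i → any (P i) (upTo (2 * N)))) t
          j , _ , tᵢⱼ = to (T-any-upTo (2 * N) (P i)) tᵢ
          n≤rank , occ = to (T-∧ {n ≤ᵇ rank (toFun v) i}) tᵢⱼ
      in i , j , to (occurs21⇔ {N} v i j) occ , ≤ᵇ⇒≤ n _ n≤rank
    from′ : HasOccurrence≥ (2 * N) (toFun v) n → T (hasOccurrence≥ᵇ N n v)
    from′ (i , j , o , n≤rank) =
      from (T-any-upTo (2 * N) (λ i → any (P i) (upTo (2 * N)))) (i , i<K o ,
        from (T-any-upTo (2 * N) (P i)) (j , j<K o ,
          from (T-∧ {n ≤ᵇ rank (toFun v) i}) (≤⇒≤ᵇ n≤rank , from (occurs21⇔ {N} v i j) o)))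

  avoids⇔ : T (avoids N n v) ⇔
            (Matching (2 * N) (toFun v) × ¬ HasOccurrence≥ (2 * N) (toFun v) n)
  avoids⇔ = mk⇔
    (λ t → let m , a = to (T-∧ {isMatching v}) t in
           to (isMatching⇔ v) m , to T-not⇔¬T a ∘ from hasOccurrence≥ᵇ⇔)
    (λ (M , ¬occ) → from (T-∧ {isMatching v})
                         (from (isMatching⇔ v) M , from T-not⇔¬T (¬occ ∘ to hasOccurrence≥ᵇ⇔)))

Avoid21From : ℕ → ℕ → Set
Avoid21From N n = Σ (Code N) (T ∘ avoids N n)

-- Counting matchings

subtype-≡ : ∀ {A : Set} {P : A → Bool} {x y : A} {px : T (P x)} {py : T (P y)} → x ≡ y →
            _≡_ {A = Σ A (T ∘ P)} (x , px) (y , py)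
subtype-≡ refl = cong (_ ,_) (T-irrelevant _ _)

module _ (N : ℕ) {f : ℕ → ℕ} (M : Matching (2 * N) f) where

  toVec : Code N
  toVec = fromFun f (closed M)

  toFun-toVec : ∀ {p} → p < 2 * N → toFun toVec p ≡ f p
  toFun-toVec = toFun-fromFun f (closed M)

  Matching-toVec : Matching (2 * N) (toFun toVec)
  Matching-toVec = Matching-cong (sym ∘ toFun-toVec) M

  toVec-unique : ∀ (v : Code N) → (∀ {p} → p < 2 * N → f p ≡ toFun v p) → toVec ≡ v
  toVec-unique = fromFun-toFun (closed M)

  toVec-isMatching : T (isMatching toVec)
  toVec-isMatching = from (isMatching⇔ toVec) Matching-toVec

module _ {N : ℕ} {f : ℕ → ℕ} where

  Matching-2*suc : Matching (2 * suc N) f → Matching (2 + 2 * N) f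
  Matching-2*suc = subst (λ K → Matching K f) (2*suc N)

  Matching-2*suc⁻ : Matching (2 + 2 * N) f → Matching (2 * suc N) f
  Matching-2*suc⁻ = subst (λ K → Matching K f) (sym (2*suc N))

<-2*suc : ∀ {N p} → p < 2 + 2 * N → p < 2 * suc N
<-2*suc {N} {p} = subst (p <_) (sym (2*suc N))

Matchings : ℕ → Set
Matchings N = Σ (Code N) (T ∘ isMatching)

module _ (N : ℕ) where

  private
    K = 2 * N

    module Remove (v : Code (suc N)) (t : T (isMatching v)) where
      M : Matching (2 + K) (toFun v)
      M = Matching-2*suc (to (isMatching⇔ v) t)
      open FirstArc M public
      1+b′≡b : suc (pred b) ≡ b
      1+b′≡b = suc-pred b {{>-nonZero 0<b}}
      partner : Fin (K + 1)
      partner = fromℕ< (subst (pred b <_) (+-comm 1 K) (subst (_≤ suc K) (sym 1+b′≡b) (≤-pred b<2+K)))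
      rest : Matchings N
      rest = toVec N Mf , toVec-isMatching N Mf

    module Insert (k : Fin (K + 1)) (w : Code N) (t : T (isMatching w)) where
      b : ℕ
      b = suc (toℕ k)
      0<b : 0 < b
      0<b = s≤s z≤n
      b<2+K : b < 2 + K
      b<2+K = s≤s (subst (toℕ k <_) (+-comm K 1) (toℕ<n k))
      F : ℕ → ℕ
      F = insertArc 0 b (toFun w)
      MF : Matching (2 + K) F
      MF = Matching-insertArc 0<b b<2+K (to (isMatching⇔ w) t)
      whole : Matchings (suc N)
      whole = toVec (suc N) (Matching-2*suc⁻ MF) , toVec-isMatching (suc N) (Matching-2*suc⁻ MF)

  matchings-suc : Matchings (suc N) ↔ (Fin (K + 1) × Matchings N)
  matchings-suc = mk↔ₛ′ remove insert remove∘insert insert∘remove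
    where
    remove : Matchings (suc N) → Fin (K + 1) × Matchings N
    remove (v , t) = Remove.partner v t , Remove.rest v t
    insert : Fin (K + 1) × Matchings N → Matchings (suc N)
    insert (k , w , t) = Insert.whole k w t
    remove∘insert : ∀ x → remove (insert x) ≡ x
    remove∘insert (k , w , t) = cong₂ _,_ partner≡k (subtype-≡ rest≡w)
      where
      open Insert k w t
      v = proj₁ whole
      module R = Remove v (proj₂ whole)
      v≗F : ∀ {q} → q < 2 + K → toFun v q ≡ F q
      v≗F q<2+K = toFun-toVec (suc N) (Matching-2*suc⁻ MF) (<-2*suc {N} q<2+K)
      R-b≡b : R.b ≡ b
      R-b≡b = trans (v≗F (s≤s z≤n)) (insertArc-left 0 b (toFun w))
      partner≡k : R.partner ≡ k
      partner≡k = toℕ-injective (trans (toℕ-fromℕ< _) (cong pred R-b≡b))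
      rest≡w : proj₁ R.rest ≡ w
      rest≡w = toVec-unique N R.Mf w λ {p} p<K → begin
          punchOut₂ 0 R.b (toFun v (punchIn₂ 0 R.b p))
            ≡⟨ cong (λ c → punchOut₂ 0 c (toFun v (punchIn₂ 0 c p))) R-b≡b ⟩
          punchOut₂ 0 b (toFun v (punchIn₂ 0 b p))
            ≡⟨ cong (punchOut₂ 0 b) (v≗F (punchIn₂-<-bound 0<b p<K)) ⟩
          removeArc 0 b F p
            ≡⟨ removeArc-insertArc 0<b (toFun w) p ⟩
          toFun w p ∎
        where open ≡-Reasoning
    insert∘remove : ∀ x → insert (remove x) ≡ x
    insert∘remove (v , t) = subtype-≡ (toVec-unique (suc N) (Matching-2*suc⁻ I.MF) v λ {q} q<2K → begin
        insertArc 0 (suc (toℕ R.partner)) (toFun w) q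
          ≡⟨ cong (λ c → insertArc 0 c (toFun w) q) 1+partner≡b ⟩
        insertArc 0 R.b (toFun w) q
          ≡⟨ insertArc-cong R.0<b R.b<2+K (toFun-toVec N R.Mf) (q<2+K q<2K) ⟩
        insertArc 0 R.b R.f q
          ≡⟨ R.insertArc-f (q<2+K q<2K) ⟩
        toFun v q ∎)
      where
      open ≡-Reasoning
      module R = Remove v t
      w = proj₁ R.rest
      module I = Insert R.partner w (proj₂ R.rest)
      q<2+K : ∀ {q} → q < 2 * suc N → q < 2 + K
      q<2+K {q} = subst (q <_) (2*suc N)
      1+partner≡b : suc (toℕ R.partner) ≡ R.b
      1+partner≡b = trans (cong suc (toℕ-fromℕ< _)) R.1+b′≡b

matchings-zero : Matchings 0 ↔ Fin 1
matchings-zero = mk↔ₛ′ (λ _ → Fin.zero) (λ _ → [] , _)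
  (λ { Fin.zero → refl ; (Fin.suc ()) }) (λ { ([] , _) → refl })

matchings-count : ∀ N → Matchings (suc N) ↔ Fin (oddDoubleFact N)
matchings-count zero    = ↔-trans (matchings-suc 0) (↔-trans (↔-refl ×-↔ matchings-zero) (↔-sym *↔×))
matchings-count (suc N) = ↔-trans (matchings-suc (suc N)) (↔-trans (↔-refl ×-↔ matchings-count N) (↔-sym *↔×))

avoid21From-top↔matchings : ∀ N → Avoid21From (suc N) N ↔ Matchings (suc N)
avoid21From-top↔matchings N = mk↔ₛ′ (λ (v , t) → v , proj₁ (to (T-∧ {isMatching v}) t))
  (λ (v , t) → v , let M = to (isMatching⇔ v) t in from (avoids⇔ {suc N} N v) (M , no-occurrence-at-top-rank N M))
  (λ _ → subtype-≡ {P = isMatching} refl)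
  (λ _ → subtype-≡ {P = avoids (suc N) N} refl)

module _ (N : ℕ) {f : ℕ → ℕ} {n : ℕ} (M : Matching (2 * N) f) (¬occ : ¬ HasOccurrence≥ (2 * N) f n) where

  toAvoid21From : Avoid21From N n
  toAvoid21From = toVec N M , from (avoids⇔ {N} n (toVec N M))
    (Matching-toVec N M , ¬occ ∘ HasOccurrence≥-cong (toFun-toVec N M))

module _ {N n : ℕ} (v : Code (suc N)) (t : T (avoids (suc N) n v)) where

  matching-2+ : Matching (2 + 2 * N) (toFun v)
  matching-2+ = Matching-2*suc (proj₁ (to (avoids⇔ {suc N} n v) t))

  avoids-2+ : ¬ HasOccurrence≥ (2 + 2 * N) (toFun v) n
  avoids-2+ = proj₂ (to (avoids⇔ {suc N} n v) t) ∘ subst (λ K → HasOccurrence≥ K (toFun v) n) (sym (2*suc N))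

-- Peeling off the inner arc of the occurrence of rank n

module Peel (N n : ℕ) (n<N : n < N) where

  private
    K = 2 * N

  module Split (v : Code (suc N)) (M : Matching (2 + K) (toFun v)) (¬occ : ¬ HasOccurrence≥ (2 + K) (toFun v) (suc n))
               (i r : ℕ) (o : Occurrence (2 + K) (toFun v) i (suc r)) (rank-i : rank (toFun v) i ≡ n) where
    a b : ℕ
    a = suc i
    b = suc r
    a<b : a < b
    a<b = Occurrence.separated o
    b<2+K : b < 2 + K
    b<2+K = <-trans (n<1+n b) (Occurrence.bounded o)
    f : ℕ → ℕ
    f = removeArc a b (toFun v)
    Mf : Matching K f
    Mf = Matching-removeArc a<b b<2+K M (Occurrence.inner o)
    insertArc-f : ∀ {q} → q < 2 + K → insertArc a b f q ≡ toFun v q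
    insertArc-f = insertArc-removeArc a<b b<2+K M (Occurrence.inner o)
    i<r : i < r
    i<r = ≤-pred a<b
    i<2N : i < K
    i<2N = <-trans i<r (≤-pred (≤-pred (Occurrence.bounded o)))
    fi≡r : f i ≡ r
    fi≡r = begin
      punchOut₂ a b (toFun v (punchIn₂ a b i)) ≡⟨ cong (punchOut₂ a b ∘ toFun v) (punchIn₂-< a<b (n<1+n i)) ⟩
      punchOut₂ a b (toFun v i)                ≡⟨ cong (punchOut₂ a b) (Occurrence.outer o) ⟩
      punchOut₂ a b (suc b)                    ≡⟨ cong (punchOut₂ a b) (punchIn₂-> a<b ≤-refl) ⟨
      punchOut₂ a b (punchIn₂ a b r)           ≡⟨ punchOut₂-punchIn₂ a<b r ⟩
      r                                        ∎
      where open ≡-Reasoning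
    rank-f-i : rank f i ≡ n
    rank-f-i = trans (sym (rank-insertArc-≤ a<b f (n≤1+n i)))
                     (trans (rank-cong insertArc-f (<⇒≤ (≤-trans i<2N (m≤n+m K 2)))) rank-i)
    module Nest = Nesting Mf i<2N fi≡r i<r rank-f-i
    result : Avoid21From N n
    result = toAvoid21From N Mf (¬occ ∘ HasOccurrence≥-cong insertArc-f ∘ Nest.lift)

  module Merge (w : Code N) (Mw : Matching K (toFun w)) (¬occ : ¬ HasOccurrence≥ K (toFun w) n)
               (l : ℕ) (l<K : l < K) (opener : l < toFun w l) (rank-l : rank (toFun w) l ≡ n) where
    module Nest = Nesting Mw l<K refl opener rank-l
    result : Avoid21From (suc N) (suc n)
    result = toAvoid21From (suc N) (Matching-2*suc⁻ Nest.MF)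
      (¬occ ∘ Nest.lower ∘ subst (λ K → HasOccurrence≥ K Nest.F (suc n)) (2*suc N))
    toFun-result : ∀ {q} → q < 2 + K → toFun (proj₁ result) q ≡ Nest.F q
    toFun-result q<2+K = toFun-toVec (suc N) (Matching-2*suc⁻ Nest.MF) (<-2*suc {N} q<2+K)

  ExactOccurrence : Code (suc N) → Set
  ExactOccurrence v = ∃₂ λ i r → Occurrence (2 + K) (toFun v) i (suc r) × rank (toFun v) i ≡ n

  exact-occurrence : ∀ {v} → ¬ HasOccurrence≥ (2 + K) (toFun v) (suc n) →
                     HasOccurrence≥ (2 + K) (toFun v) n → ExactOccurrence v
  exact-occurrence ¬occ (i , zero , o , _) with () ← Occurrence.separated o
  exact-occurrence ¬occ (i , suc r , o , n≤rank) =
    i , r , o , ≤-antisym (≮⇒≥ (λ n<rank → ¬occ (i , suc r , o , n<rank))) n≤rank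

  split : (v : Code (suc N)) → T (avoids (suc N) (suc n) v) → ExactOccurrence v → Avoid21From N n
  split v t (i , r , o , rank-i) = Split.result v (matching-2+ {N} {suc n} v t) (avoids-2+ {N} {suc n} v t) i r o rank-i

  module MergeOf (w : Code N) (t : T (avoids N n w)) where
    Mw = proj₁ (to (avoids⇔ {N} n w) t)
    ¬occ = proj₂ (to (avoids⇔ {N} n w) t)
    witness = rank-surjective N Mw n<N
    l = proj₁ witness
    l<K = proj₁ (proj₂ witness)
    opener = proj₁ (proj₂ (proj₂ witness))
    rank-l = proj₂ (proj₂ (proj₂ witness))
    open Merge w Mw ¬occ l l<K opener rank-l public

  merge : Avoid21From N n → Avoid21From (suc N) (suc n)
  merge (w , t) = MergeOf.result w t

  weaken : Avoid21From (suc N) n → Avoid21From (suc N) (suc n)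
  weaken (v , t) = v , from (avoids⇔ {suc N} (suc n) v)
    (M , λ (i , j , o , 1+n≤rank) → ¬occ (i , j , o , ≤-trans (n≤1+n n) 1+n≤rank))
    where
    M = proj₁ (to (avoids⇔ {suc N} n v) t)
    ¬occ = proj₂ (to (avoids⇔ {suc N} n v) t)

  exact-occurrence-of : (v : Code (suc N)) → T (avoids (suc N) (suc n) v) → hasOccurrence≥ᵇ (suc N) n v ≡ true →
                        ExactOccurrence v
  exact-occurrence-of v t eq = exact-occurrence {v} (avoids-2+ {N} {suc n} v t)
    (subst (λ K → HasOccurrence≥ K (toFun v) n) (2*suc N)
           (to (hasOccurrence≥ᵇ⇔ {suc N} n v) (subst T (sym eq) tt)))

  -- The value of the test comes with its equation, so that proofs about peel can case on it.
  classify : (v : Code (suc N)) → T (avoids (suc N) (suc n) v) →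
             ∀ β → hasOccurrence≥ᵇ (suc N) n v ≡ β → Avoid21From (suc N) n ⊎ Avoid21From N n
  classify v t false eq =
    inj₁ (v , from (T-∧ {isMatching v}) (proj₁ (to (T-∧ {isMatching v}) t) , subst (T ∘ not) (sym eq) tt))
  classify v t true eq = inj₂ (split v t (exact-occurrence-of v t eq))

  peel : Avoid21From (suc N) (suc n) → Avoid21From (suc N) n ⊎ Avoid21From N n
  peel (v , t) = classify v t (hasOccurrence≥ᵇ (suc N) n v) refl

  unpeel : Avoid21From (suc N) n ⊎ Avoid21From N n → Avoid21From (suc N) (suc n)
  unpeel (inj₁ x) = weaken x
  unpeel (inj₂ y) = merge y

  merge∘split : ∀ v t ω → proj₁ (merge (split v t ω)) ≡ v
  merge∘split v t (i , r , o , rank-i) = toVec-unique (suc N) (Matching-2*suc⁻ G.Nest.MF) v λ {q} q<2S →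
    let q<2+K = subst (q <_) (2*suc N) q<2S in begin
      insertArc (suc G.l) (suc (toFun w G.l)) (toFun w) q
        ≡⟨ cong₂ (λ x y → insertArc (suc x) (suc y) (toFun w) q) l≡i wl≡r ⟩
      insertArc S.a S.b (toFun w) q                        ≡⟨ insertArc-cong S.a<b S.b<2+K w≗f q<2+K ⟩
      insertArc S.a S.b S.f q                              ≡⟨ S.insertArc-f q<2+K ⟩
      toFun v q                                            ∎
    where
    open ≡-Reasoning
    module S = Split v (matching-2+ {N} {suc n} v t) (avoids-2+ {N} {suc n} v t) i r o rank-i
    w = proj₁ S.result
    module G = MergeOf w (proj₂ S.result)
    w≗f : ∀ {p} → p < K → toFun w p ≡ S.f p
    w≗f = toFun-toVec N S.Mf
    wi≡r : toFun w i ≡ r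
    wi≡r = trans (w≗f S.i<2N) S.fi≡r
    l≡i : G.l ≡ i
    l≡i = countBelow-injective (isOpener (toFun w))
      (isOpener-intro {toFun w} G.opener)
      (isOpener-intro {toFun w} (subst (i <_) (sym wi≡r) S.i<r))
      (trans G.rank-l (sym (trans (rank-cong w≗f (<⇒≤ S.i<2N)) S.rank-f-i)))
    wl≡r : toFun w G.l ≡ r
    wl≡r = trans (cong (toFun w) l≡i) wi≡r

  split∘merge : ∀ w t ω → proj₁ (split (proj₁ (merge (w , t))) (proj₂ (merge (w , t))) ω) ≡ w
  split∘merge w t (i , r , o , rank-i) = toVec-unique N S.Mf w λ {p} p<K → begin
      punchOut₂ (suc i) (suc r) (toFun v (punchIn₂ (suc i) (suc r) p))
        ≡⟨ cong₂ (λ x y → punchOut₂ x y (toFun v (punchIn₂ x y p))) (cong suc i≡l) r≡wl ⟩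
      punchOut₂ G.Nest.a G.Nest.b (toFun v (punchIn₂ G.Nest.a G.Nest.b p))
        ≡⟨ cong (punchOut₂ G.Nest.a G.Nest.b) (G.toFun-result (punchIn₂-<-bound G.Nest.a<b p<K)) ⟩
      removeArc G.Nest.a G.Nest.b G.Nest.F p
        ≡⟨ removeArc-insertArc G.Nest.a<b (toFun w) p ⟩
      toFun w p ∎
    where
    open ≡-Reasoning
    module G = MergeOf w t
    v = proj₁ G.result
    t′ = proj₂ G.result
    module S = Split v (matching-2+ {N} {suc n} v t′) (avoids-2+ {N} {suc n} v t′) i r o rank-i
    i≤2+K = <⇒≤ (<-trans (n<1+n i) (Occurrence.1+i<K o))
    unique = G.Nest.unique (Occurrence-cong G.toFun-result o) (trans (sym (rank-cong G.toFun-result i≤2+K)) rank-i)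
    i≡l : i ≡ G.l
    i≡l = proj₁ unique
    r≡wl : suc r ≡ G.Nest.b
    r≡wl = proj₂ unique

  peel-↔ : Avoid21From (suc N) (suc n) ↔ (Avoid21From (suc N) n ⊎ Avoid21From N n)
  peel-↔ = mk↔ₛ′ peel unpeel peel∘unpeel unpeel∘peel
    where
    unpeel∘peel : ∀ x → unpeel (peel x) ≡ x
    unpeel∘peel (v , t) = go (hasOccurrence≥ᵇ (suc N) n v) refl
      where
      go : ∀ β eq → unpeel (classify v t β eq) ≡ (v , t)
      go false eq = subtype-≡ {P = avoids (suc N) (suc n)} refl
      go true  eq = subtype-≡ {P = avoids (suc N) (suc n)} (merge∘split v t (exact-occurrence-of v t eq))
    peel∘unpeel : ∀ y → peel (unpeel y) ≡ y
    peel∘unpeel (inj₁ (v , t)) = go (hasOccurrence≥ᵇ (suc N) n v) refl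
      where
      go : ∀ β eq → classify v (proj₂ (weaken (v , t))) β eq ≡ inj₁ (v , t)
      go false eq = cong inj₁ (subtype-≡ {P = avoids (suc N) n} refl)
      go true  eq = ⊥-elim (to T-not⇔¬T (proj₂ (to (T-∧ {isMatching v}) t)) (subst T (sym eq) tt))
    peel∘unpeel (inj₂ (w , t)) = go (hasOccurrence≥ᵇ (suc N) n v) refl
      where
      module G = MergeOf w t
      v = proj₁ G.result
      go : ∀ β eq → classify v (proj₂ G.result) β eq ≡ inj₂ (w , t)
      go true  eq =
        cong inj₂ (subtype-≡ {P = avoids N n} (split∘merge w t (exact-occurrence-of v (proj₂ G.result) eq)))
      go false eq = ⊥-elim (subst T eq (from (hasOccurrence≥ᵇ⇔ {suc N} n v) nested))
        where
        nested : HasOccurrence≥ (2 * suc N) (toFun v) n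
        nested = G.l , G.Nest.b ,
          subst (λ K → Occurrence K (toFun v) G.l G.Nest.b) (sym (2*suc N))
                (Occurrence-cong (sym ∘ G.toFun-result) G.Nest.nested-occurrence) ,
          ≤-reflexive (sym (trans (rank-cong G.toFun-result (<⇒≤ (≤-trans G.l<K (m≤n+m K 2)))) G.Nest.rank-F-l))

oddDoubleFactℤ : ℕ → ℤ
oddDoubleFactℤ k = + oddDoubleFact k

pos-difference : ∀ {c d e x y} → d + c ≡ e → + e ≡ x → + c ≡ y → + d ≡ x ℤ.- y
pos-difference {c} {d} refl refl refl = begin
    + d                  ≡⟨ cancel (+ d) (+ c) ⟨
    + d ℤ.+ + c ℤ.- + c  ≡⟨ cong (ℤ._- + c) (ℤP.pos-+ d c) ⟨
    + (d + c) ℤ.- + c    ∎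
  where
  open ≡-Reasoning
  cancel : ∀ a b → a ℤ.+ b ℤ.- b ≡ a
  cancel = solve-∀

avoid21From-count : ∀ r n → Σ ℕ λ c → (Avoid21From (suc (r + n)) n ↔ Fin c) × (+ c ≡ Δ r oddDoubleFactℤ n)
avoid21From-count zero    n = oddDoubleFact n , ↔-trans (avoid21From-top↔matchings n) (matchings-count n) , refl
avoid21From-count (suc r) n =
  let c₁ , e₁ , c₁≡Δ = avoid21From-count r (suc n)
      c₂ , e₂ , c₂≡Δ = avoid21From-count r n
      d , e , d+c₂≡c₁ = ↔-cancelʳ-Fin c₂ c₁
        (↔-trans (⊎-cong ↔-refl (↔-sym e₂))
        (↔-trans (↔-sym (Peel.peel-↔ (suc (r + n)) n (s≤s (m≤n+m n r))))
                 (subst (λ m → Avoid21From (suc m) (suc n) ↔ Fin c₁) (+-suc r n) e₁)))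
  in d , e , pos-difference d+c₂≡c₁ c₁≡Δ c₂≡Δ

lemma3 : (n : ℕ) → Σ ℕ (λ a → (Avoid21 (suc n) ↔ Fin a) × (+ a ≡ rhs n))
lemma3 n =
  let c , avoid↔c , c≡Δ = avoid21From-count n 0 in
  c , subst (λ m → Avoid21From (suc m) 0 ↔ Fin c) (+-identityʳ n) avoid↔c ,
  trans c≡Δ (trans (Δ-binomial n oddDoubleFactℤ 0) (sym (rhs≡binomialTransform n)))
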